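{- Let $G=(V,E)$ be a trivalent $2$-edge-connected graph of genus $g=|E|-|V|+1$. Then the rank of the graph curve matroid $M_G$ is $g-1$.
   Context: Graphs are finite and undirected and may have parallel edges; trivalent means every vertex has degree $3$. For such $G$ one has $|V|=2g-2$ and $|E|=3g-3$. $r^*$ is the rank function of the bond (cographic) matroid of $G$. For $A\subseteq V$, $\delta(A)$ is the set of edges incident to at least one vertex of $A$. The graph curve matroid $M_G$ is the matroid on $V$ whose circuits are the non-empty subsets $A\subseteq V$ that are inclusion-minimal among non-empty subsets satisfying $r^*(\delta(A))\le|A|$. -}

module Defs where

open import Data.Nat using (ℕ; zero; suc; _+_; _∸_; _≤_; _<ᵇ_)
open import Data.Bool using (Bool; true; false; _∧_; _∨_; not; if_then_else_)
open import Data.Fin using (Fin; toℕ) renaming (zero to fz; suc to fs)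
open import Data.Fin.Properties using (_≟_)
open import Data.Product using (_×_; _,_; proj₁; proj₂; ∃)
open import Data.Vec using (lookup; tabulate)
open import Data.Fin.Subset using (Subset; ∣_∣; ∁; ⊤; _-_; Nonempty; _⊂_; _⊆_)
open import Relation.Nullary using (¬_)
open import Relation.Nullary.Decidable using (⌊_⌋)
open import Relation.Binary.PropositionalEquality using (_≡_)

record Graph : Set where
  field
    n    : ℕ
    m    : ℕ
    ends : Fin m → Fin n × Fin n
open Graph public

cnt : ∀ {k} → (Fin k → Bool) → ℕ
cnt {zero}  f = 0
cnt {suc k} f = (if f fz then 1 else 0) + cnt (λ i → f (fs i))

anyF : ∀ {k} → (Fin k → Bool) → Bool
anyF {zero}  f = false
anyF {suc k} f = f fz ∨ anyF (λ i → f (fs i))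

module _ (G : Graph) where

  -- degree of a vertex (a loop would count twice)
  degree : Fin (n G) → ℕ
  degree v = cnt (λ e → ⌊ proj₁ (ends G e) ≟ v ⌋) + cnt (λ e → ⌊ proj₂ (ends G e) ≟ v ⌋)

  Trivalent : Set
  Trivalent = ∀ v → degree v ≡ 3

  reachW : Subset (m G) → ℕ → Fin (n G) → Fin (n G) → Bool
  reachW Y zero    u v = ⌊ u ≟ v ⌋
  reachW Y (suc k) u v = reachW Y k u v ∨
    anyF (λ e → lookup Y e ∧
      ((⌊ proj₁ (ends G e) ≟ v ⌋ ∧ reachW Y k u (proj₂ (ends G e))) ∨
       (⌊ proj₂ (ends G e) ≟ v ⌋ ∧ reachW Y k u (proj₁ (ends G e)))))

  -- u and v lie in the same connected component of the spanning subgraph (V, Y)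
  -- (walks of length ≤ |V| suffice)
  Reach : Subset (m G) → Fin (n G) → Fin (n G) → Bool
  Reach Y = reachW Y (n G)

  ConnectedSub : Subset (m G) → Set
  ConnectedSub Y = ∀ u v → Reach Y u v ≡ true

  Connected : Set
  Connected = ConnectedSub ⊤

  TwoEdgeConnected : Set
  TwoEdgeConnected = Connected × (∀ e → ConnectedSub (⊤ - e))

  genus : ℕ
  genus = m G + 1 ∸ n G

  -- number of connected components of (V, Y): count vertices that are the
  -- smallest (w.r.t. Fin order) in their component
  components : Subset (m G) → ℕ
  components Y = cnt (λ v → not (anyF (λ u → (toℕ u <ᵇ toℕ v) ∧ Reach Y u v)))

  graphicRank : Subset (m G) → ℕ
  graphicRank Y = n G ∸ components Y

  -- rank function of the bond (cographic) matroid = dual of the graphic matroid: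
  -- r*(X) = |X| + r(E \ X) - r(E)
  bondRank : Subset (m G) → ℕ
  bondRank X = ∣ X ∣ + graphicRank (∁ X) ∸ graphicRank ⊤

  δ : Subset (n G) → Subset (m G)
  δ A = tabulate (λ e → lookup A (proj₁ (ends G e)) ∨ lookup A (proj₂ (ends G e)))

  Tight : Subset (n G) → Set
  Tight A = bondRank (δ A) ≤ ∣ A ∣

  -- circuits of the graph curve matroid M_G: inclusion-minimal non-empty subsets
  -- satisfying r*(δ(A)) ≤ |A|
  IsCircuit : Subset (n G) → Set
  IsCircuit A = Nonempty A × Tight A × (∀ B → Nonempty B → B ⊂ A → ¬ Tight B)

  Independent : Subset (n G) → Set
  Independent I = ∀ C → C ⊆ I → ¬ IsCircuit C

  MatroidRank : ℕ → Set
  MatroidRank r = (∃ λ I → Independent I × ∣ I ∣ ≡ r) × (∀ I → Independent I → ∣ I ∣ ≤ r)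

-- A vertex set is independent in M_G exactly when none of its non-empty subsets A is tight, i.e. the
-- bond rank of δ(A) always exceeds |A|.  Bond ranks are at most g, so any g vertices are tight and the
-- rank is at most g − 1.  Conversely, build an ear decomposition of the 2-edge-connected graph: a cycle,
-- then ears and chords, each leaving the part built so far at a vertex x whose third edge f is the only
-- one not yet used (trivalence).  Each step adds one edge more than it adds vertices, so the vertices x
-- form a set I of size |E| − |V| = g − 1.  The invariant is that every non-empty A ⊆ I is loose in the
-- current bridgeless subgraph Y (its bond rank in Y exceeds |A|).  Adding x to A may use up this slack;
-- it is regained by the last edge of the step, which joins two vertices already linked in Y: the chord f
-- lies in δ(A), and for an ear, f ∈ δ(A) isolates the new vertices in Y ∖ δ(A), so that the closing edge
-- reconnects two components of Y ∖ δ(A).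

module Submission where

open import Defs
open import Algebra.Properties.CommutativeSemigroup using (interchange)
open import Data.Bool using (Bool; true; false; _∧_; _∨_; _xor_; not; if_then_else_)
open import Data.Bool.Properties using (∧-comm; ∨-identityʳ; ∨-zeroʳ; ∧-identityʳ; ∧-zeroʳ; not-injective; ¬-not; T-≡)
open import Data.Empty using (⊥; ⊥-elim)
open import Data.Fin using (Fin; toℕ) renaming (zero to fz; suc to fs)
open import Data.Fin.Properties using (_≟_; toℕ-injective; ¬Fin0) renaming (suc-injective to fs-injective)
open import Data.Fin.Subset using (Subset; ∣_∣; ⊤; _-_; ∁; Nonempty; _⊂_) renaming (⊥ to ∅)
open import Data.Fin.Subset.Properties using (p⊂q⇒∣p∣<∣q∣; ∣p∣≤n)
open import Data.Nat using (ℕ; zero; suc; _+_; _∸_; _≤_; _<_; z≤n; s≤s; _<ᵇ_; _≤?_)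
open import Data.Nat.Properties hiding (_≟_)
open import Data.Nat.Solver using (module +-*-Solver)
open import Data.Product using (_×_; _,_; proj₁; proj₂; ∃; Σ)
open import Data.Sum using (_⊎_; inj₁; inj₂)
open import Data.Vec using ([]; _∷_; lookup; tabulate; zipWith)
open import Data.Vec.Properties using (lookup-replicate; lookup∘tabulate; lookup-map; []=⇒lookup; lookup⇒[]=)
open import Function using (_∘_)
open import Function.Bundles using (Equivalence)
open import Relation.Binary.Definitions using (tri<; tri≈; tri>)
open import Relation.Binary.PropositionalEquality
open import Relation.Nullary using (¬_; yes; no)
open import Relation.Nullary.Decidable using (⌊_⌋; ⌊⌋-map′)

∧-elim : ∀ {a b} → a ∧ b ≡ true → a ≡ true × b ≡ true
∧-elim {true} {true} _ = refl , refl

∧-intro : ∀ {a b} → a ≡ true → b ≡ true → a ∧ b ≡ true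
∧-intro refl refl = refl

∨-elim : ∀ {a b} → a ∨ b ≡ true → a ≡ true ⊎ b ≡ true
∨-elim {true}  _ = inj₁ refl
∨-elim {false} p = inj₂ p

∨-introˡ : ∀ {a} b → a ≡ true → a ∨ b ≡ true
∨-introˡ b refl = refl

∨-introʳ : ∀ a {b} → b ≡ true → a ∨ b ≡ true
∨-introʳ true  _ = refl
∨-introʳ false p = p

true≢false : ∀ {a} → a ≡ true → a ≡ false → ⊥
true≢false refl ()

bool-cases : (a : Bool) → a ≡ true ⊎ a ≡ false
bool-cases true  = inj₁ refl
bool-cases false = inj₂ refl

bool-ext : ∀ {a b} → (a ≡ true → b ≡ true) → (b ≡ true → a ≡ true) → a ≡ b
bool-ext {true}  {true}  _ _ = refl
bool-ext {true}  {false} f _ = sym (f refl)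
bool-ext {false} {true}  _ g = g refl
bool-ext {false} {false} _ _ = refl

module _ {k : ℕ} where

  ≟-sound : {x y : Fin k} → ⌊ x ≟ y ⌋ ≡ true → x ≡ y
  ≟-sound {x} {y} p with x ≟ y
  ... | yes x≡y = x≡y

  ≟-refl : (x : Fin k) → ⌊ x ≟ x ⌋ ≡ true
  ≟-refl x with x ≟ x
  ... | yes _   = refl
  ... | no x≢x = ⊥-elim (x≢x refl)

  ≟-≡ : {x y : Fin k} → x ≡ y → ⌊ x ≟ y ⌋ ≡ true
  ≟-≡ refl = ≟-refl _

  ≟-≢ : {x y : Fin k} → x ≢ y → ⌊ x ≟ y ⌋ ≡ false
  ≟-≢ {x} {y} x≢y with x ≟ y
  ... | yes x≡y = ⊥-elim (x≢y x≡y)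
  ... | no _    = refl

<ᵇ-sound : ∀ {a b} → (a <ᵇ b) ≡ true → a < b
<ᵇ-sound {a} {b} p = <ᵇ⇒< a b (Equivalence.from T-≡ p)

<ᵇ-complete : ∀ {a b} → a < b → (a <ᵇ b) ≡ true
<ᵇ-complete lt = Equivalence.to T-≡ (<⇒<ᵇ lt)

module _ {k : ℕ} where

  infix  4 _⊑_ _≐_
  infixr 7 _∩_
  infixr 6 _∪_
  infixl 6 _∖_

  _⊑_ : (Fin k → Bool) → (Fin k → Bool) → Set
  Z ⊑ Z′ = ∀ i → Z i ≡ true → Z′ i ≡ true

  _≐_ : (Fin k → Bool) → (Fin k → Bool) → Set
  Z ≐ Z′ = ∀ i → Z i ≡ Z′ i

  ⁅_⁆ : Fin k → Fin k → Bool
  ⁅ j ⁆ i = ⌊ i ≟ j ⌋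

  ∁ᶠ : (Fin k → Bool) → Fin k → Bool
  ∁ᶠ Z i = not (Z i)

  _∪_ _∩_ _∖_ : (Fin k → Bool) → (Fin k → Bool) → Fin k → Bool
  (Z ∪ W) i = Z i ∨ W i
  (Z ∩ W) i = Z i ∧ W i
  (Z ∖ W) i = Z i ∧ not (W i)

  ⊑-∪ : ∀ Z W → Z ⊑ Z ∪ W
  ⊑-∪ Z W i p = ∨-introˡ (W i) p

  ∪⁅⁆-new : ∀ Z j → (Z ∪ ⁅ j ⁆) j ≡ true
  ∪⁅⁆-new Z j = ∨-introʳ (Z j) (≟-refl j)

  ∪⁅⁆-elim : ∀ Z j {i} → (Z ∪ ⁅ j ⁆) i ≡ true → Z i ≡ true ⊎ i ≡ j
  ∪⁅⁆-elim Z j {i} p with ∨-elim {Z i} p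
  ... | inj₁ Zi = inj₁ Zi
  ... | inj₂ q  = inj₂ (≟-sound q)

  ∈-∉-≢ : ∀ {Z : Fin k → Bool} {i j} → Z i ≡ true → Z j ≡ false → i ≢ j
  ∈-∉-≢ Zi Zj refl = true≢false Zi Zj

  ∪⁅⁆-other : ∀ Z j {i} → i ≢ j → (Z ∪ ⁅ j ⁆) i ≡ Z i
  ∪⁅⁆-other Z j {i} i≢j rewrite ≟-≢ i≢j = ∨-identityʳ (Z i)

  ∪⁅⁆-present : ∀ Z j → Z j ≡ true → Z ∪ ⁅ j ⁆ ≐ Z
  ∪⁅⁆-present Z j Zj i with i ≟ j
  ... | yes refl = trans (∨-introʳ (Z j) refl) (sym Zj)
  ... | no _     = ∨-identityʳ (Z i)

  ∖⁅⁆-∪⁅⁆ : ∀ Z j → Z j ≡ true → (Z ∖ ⁅ j ⁆) ∪ ⁅ j ⁆ ≐ Z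
  ∖⁅⁆-∪⁅⁆ Z j Zj i with i ≟ j
  ... | yes refl = trans (∨-introʳ (Z j ∧ false) refl) (sym Zj)
  ... | no _     = trans (∨-identityʳ _) (∧-identityʳ (Z i))

  ∖⁅⁆-other : ∀ Z j {i} → Z i ≡ true → i ≢ j → (Z ∖ ⁅ j ⁆) i ≡ true
  ∖⁅⁆-other Z j Zi i≢j = ∧-intro Zi (cong not (≟-≢ i≢j))

  ∖⁅⁆-removed : ∀ Z j → (Z ∖ ⁅ j ⁆) j ≡ false
  ∖⁅⁆-removed Z j = trans (cong (λ b → Z j ∧ not b) (≟-refl j)) (∧-zeroʳ (Z j))

  ∩-monoˡ : ∀ {Z Z′} → Z ⊑ Z′ → ∀ W → Z ∩ W ⊑ Z′ ∩ W
  ∩-monoˡ h W i p = let (a , b) = ∧-elim p in ∧-intro (h i a) b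

  ∖-monoˡ : ∀ {Z Z′} → Z ⊑ Z′ → ∀ W → Z ∖ W ⊑ Z′ ∖ W
  ∖-monoˡ h W i p = let (a , b) = ∧-elim p in ∧-intro (h i a) b

  ⊑-∪⁅⁆-∖⁅⁆ : ∀ Z j → Z j ≡ false → Z ⊑ (Z ∪ ⁅ j ⁆) ∖ ⁅ j ⁆
  ⊑-∪⁅⁆-∖⁅⁆ Z j Zj i p with i ≟ j
  ... | yes refl = ⊥-elim (true≢false p Zj)
  ... | no _     = ∧-intro (∨-introˡ _ p) refl

  ∖-swap : ∀ Z W X → (Z ∖ W) ∖ X ≐ (Z ∖ X) ∖ W
  ∖-swap Z W X i with Z i | W i | X i
  ... | true  | true  | true  = refl
  ... | true  | true  | false = refl
  ... | true  | false | true  = refl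
  ... | true  | false | false = refl
  ... | false | _     | _     = refl

  ∖-∖ : ∀ Z W X → (Z ∖ W) ∖ X ≐ Z ∖ (W ∪ X)
  ∖-∖ Z W X i with Z i | W i | X i
  ... | true  | true  | _     = refl
  ... | true  | false | true  = refl
  ... | true  | false | false = refl
  ... | false | _     | _     = refl

  ∖-antitoneʳ : ∀ Z {W W′} → W ⊑ W′ → Z ∖ W′ ⊑ Z ∖ W
  ∖-antitoneʳ Z {W} {W′} h i p with bool-cases (W i)
  ... | inj₁ Wi = ⊥-elim (true≢false (h i Wi) (not-injective (proj₂ (∧-elim p))))
  ... | inj₂ Wi = ∧-intro (proj₁ (∧-elim p)) (cong not Wi)

  ∩-∖-comm : ∀ Z W X → (Z ∩ W) ∖ X ≐ (Z ∖ X) ∖ (Z ∖ W)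
  ∩-∖-comm Z W X i with Z i | W i | X i
  ... | true  | true  | true  = refl
  ... | true  | true  | false = refl
  ... | true  | false | true  = refl
  ... | true  | false | false = refl
  ... | false | _     | _     = refl

  ∩-∖-∩ : ∀ Z W W′ → (Z ∩ W) ∖ (Z ∩ W′) ≐ (Z ∖ W′) ∖ (Z ∖ W)
  ∩-∖-∩ Z W W′ i with Z i | W i | W′ i
  ... | true  | true  | true  = refl
  ... | true  | true  | false = refl
  ... | true  | false | true  = refl
  ... | true  | false | false = refl
  ... | false | _     | _     = refl

  ∪⁅⁆-∖-inside : ∀ Z W j → W j ≡ true → (Z ∪ ⁅ j ⁆) ∖ W ≐ Z ∖ W
  ∪⁅⁆-∖-inside Z W j Wj i with i ≟ j
  ... | yes refl rewrite Wj = trans (∧-zeroʳ _) (sym (∧-zeroʳ (Z j)))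
  ... | no _     = cong (_∧ not (W i)) (∨-identityʳ (Z i))

  ∪⁅⁆-∖-outside : ∀ Z W j → W j ≡ false → (Z ∪ ⁅ j ⁆) ∖ W ≐ (Z ∖ W) ∪ ⁅ j ⁆
  ∪⁅⁆-∖-outside Z W j Wj i with i ≟ j
  ... | yes refl rewrite Wj = trans (∧-identityʳ _) (trans (∨-zeroʳ (Z j)) (sym (∨-zeroʳ _)))
  ... | no _     = trans (cong (_∧ not (W i)) (∨-identityʳ (Z i))) (sym (∨-identityʳ _))

  ∪⁅⁆-∩-inside : ∀ Z W j → W j ≡ true → (Z ∪ ⁅ j ⁆) ∩ W ≐ (Z ∩ W) ∪ ⁅ j ⁆
  ∪⁅⁆-∩-inside Z W j Wj i with i ≟ j
  ... | yes refl rewrite Wj = trans (∧-identityʳ _) (trans (∨-zeroʳ (Z j)) (sym (∨-zeroʳ _)))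
  ... | no _     = trans (cong (_∧ W i) (∨-identityʳ (Z i))) (sym (∨-identityʳ _))

  ∪⁅⁆-∩-outside : ∀ Z W j → W j ≡ false → (Z ∪ ⁅ j ⁆) ∩ W ≐ Z ∩ W
  ∪⁅⁆-∩-outside Z W j Wj i with i ≟ j
  ... | yes refl rewrite Wj = trans (∧-zeroʳ _) (sym (∧-zeroʳ (Z j)))
  ... | no _     = cong (_∧ W i) (∨-identityʳ (Z i))

iverson : Bool → ℕ
iverson b = if b then 1 else 0

iverson≤1 : ∀ b → iverson b ≤ 1
iverson≤1 true  = s≤s z≤n
iverson≤1 false = z≤n

iverson-mono : ∀ {a b} → (a ≡ true → b ≡ true) → iverson a ≤ iverson b
iverson-mono {false} _ = z≤n
iverson-mono {true}  h rewrite h refl = s≤s z≤n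

iverson-split : ∀ a b → iverson a ≡ iverson (a ∧ b) + iverson (a ∧ not b)
iverson-split true  true  = refl
iverson-split true  false = refl
iverson-split false _     = refl

cnt-cong : ∀ {k} {f g : Fin k → Bool} → f ≐ g → cnt f ≡ cnt g
cnt-cong {zero}  _ = refl
cnt-cong {suc k} h rewrite h fz = cong (_ +_) (cnt-cong (λ i → h (fs i)))

cnt≤ : ∀ {k} (f : Fin k → Bool) → cnt f ≤ k
cnt≤ {zero}  _ = z≤n
cnt≤ {suc k} f = +-mono-≤ (iverson≤1 (f fz)) (cnt≤ (λ i → f (fs i)))

cnt-mono : ∀ {k} {f g : Fin k → Bool} → f ⊑ g → cnt f ≤ cnt g
cnt-mono {zero}  _ = z≤n
cnt-mono {suc k} h = +-mono-≤ (iverson-mono (h fz)) (cnt-mono (λ i → h (fs i)))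

cnt-mono-< : ∀ {k} {f g : Fin k → Bool} → f ⊑ g → (i : Fin k) → g i ≡ true → f i ≡ false → cnt f < cnt g
cnt-mono-< {suc k} h fz gi fi rewrite gi | fi = s≤s (cnt-mono (λ i → h (fs i)))
cnt-mono-< {suc k} {f} {g} h (fs i) gi fi =
  subst (_≤ iverson (g fz) + cnt (λ j → g (fs j))) (+-suc (iverson (f fz)) _)
    (+-mono-≤ (iverson-mono (h fz)) (cnt-mono-< (λ j → h (fs j)) i gi fi))

cnt-false : ∀ {k} {f : Fin k → Bool} → (∀ i → f i ≡ false) → cnt f ≡ 0
cnt-false {zero}  _ = refl
cnt-false {suc k} h rewrite h fz = cnt-false (λ i → h (fs i))

cnt-true : ∀ {k} → cnt {k} (λ _ → true) ≡ k
cnt-true {zero}  = refl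
cnt-true {suc k} = cong suc (cnt-true {k})

cnt-pos : ∀ {k} {f : Fin k → Bool} (i : Fin k) → f i ≡ true → 1 ≤ cnt f
cnt-pos {k} {f} i fi =
  subst (λ c → suc c ≤ cnt f) (cnt-false {k} {λ _ → false} (λ _ → refl))
        (cnt-mono-< (λ _ ()) i fi refl)

cnt-pos⇒∃ : ∀ {k} (f : Fin k → Bool) → 1 ≤ cnt f → ∃ λ i → f i ≡ true
cnt-pos⇒∃ {suc k} f p with bool-cases (f fz)
... | inj₁ f0 = fz , f0
... | inj₂ f0 rewrite f0 with cnt-pos⇒∃ (λ i → f (fs i)) p
...   | i , fi = fs i , fi

cnt≡0⇒false : ∀ {k} {f : Fin k → Bool} → cnt f ≡ 0 → ∀ i → f i ≡ false
cnt≡0⇒false c i = ¬-not (λ fi → <-irrefl refl (≤-trans (cnt-pos i fi) (≤-reflexive c)))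

cnt-suc-at : ∀ {k} {f g : Fin k → Bool} (j : Fin k) → (∀ i → i ≢ j → f i ≡ g i) →
             f j ≡ true → g j ≡ false → cnt f ≡ suc (cnt g)
cnt-suc-at {suc k} fz h fj gj rewrite fj | gj = cong suc (cnt-cong (λ i → h (fs i) (λ ())))
cnt-suc-at {suc k} {f} {g} (fs j) h fj gj rewrite h fz (λ ()) =
  trans (cong (iverson (g fz) +_) (cnt-suc-at j (λ i i≢j → h (fs i) (i≢j ∘ fs-injective)) fj gj))
        (+-suc (iverson (g fz)) _)

cnt-split : ∀ {k} (f p : Fin k → Bool) → cnt f ≡ cnt (f ∩ p) + cnt (f ∖ p)
cnt-split {zero}  _ _ = refl
cnt-split {suc k} f p
  rewrite cnt-split (λ i → f (fs i)) (λ i → p (fs i)) | iverson-split (f fz) (p fz) =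
  interchange +-commutativeSemigroup (iverson (f fz ∧ p fz)) (iverson (f fz ∧ not (p fz))) _ _

cnt-∪ : ∀ {k} (f g : Fin k → Bool) → (∀ i → f i ≡ true → g i ≡ false) → cnt (f ∪ g) ≡ cnt f + cnt g
cnt-∪ f g disjoint = trans (cnt-split (f ∪ g) f) (cong₂ _+_ (cnt-cong left) (cnt-cong right))
  where
  left : ∀ i → (f i ∨ g i) ∧ f i ≡ f i
  left i with f i
  ... | true  = refl
  ... | false = ∧-zeroʳ (g i)
  right : ∀ i → (f i ∨ g i) ∧ not (f i) ≡ g i
  right i with bool-cases (f i)
  ... | inj₁ fi rewrite fi = sym (disjoint i fi)
  ... | inj₂ fi rewrite fi = ∧-identityʳ (g i)

cnt-≥2 : ∀ {k} {f : Fin k → Bool} i j → i ≢ j → f i ≡ true → f j ≡ true → 2 ≤ cnt f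
cnt-≥2 {f = f} i j i≢j fi fj =
  ≤-trans (s≤s (cnt-pos i (∖⁅⁆-other f j fi i≢j))) (cnt-mono-< (λ _ p → proj₁ (∧-elim p)) j fj (∖⁅⁆-removed f j))

module _ {k : ℕ} where

  cnt-∪⁅⁆ : ∀ (Z : Fin k → Bool) j → Z j ≡ false → cnt (Z ∪ ⁅ j ⁆) ≡ suc (cnt Z)
  cnt-∪⁅⁆ Z j Zj = cnt-suc-at j (λ _ i≢j → ∪⁅⁆-other Z j i≢j) (∪⁅⁆-new Z j) Zj

  cnt-∖⁅⁆ : ∀ (Z : Fin k → Bool) j → Z j ≡ true → cnt Z ≡ suc (cnt (Z ∖ ⁅ j ⁆))
  cnt-∖⁅⁆ Z j Zj = cnt-suc-at j (λ i i≢j → sym (trans (cong (λ b → Z i ∧ not b) (≟-≢ i≢j)) (∧-identityʳ (Z i))))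
                     Zj (∖⁅⁆-removed Z j)

  cnt-⁅⁆ : ∀ (j : Fin k) → cnt ⁅ j ⁆ ≡ 1
  cnt-⁅⁆ j = trans (cnt-suc-at {g = λ _ → false} j (λ _ i≢j → ≟-≢ i≢j) (≟-refl j) refl)
                   (cong suc (cnt-false {k} (λ _ → refl)))

  ⊑-∖≡0⇒≐ : ∀ {Z Z′ : Fin k → Bool} → Z ⊑ Z′ → cnt (Z′ ∖ Z) ≡ 0 → Z ≐ Z′
  ⊑-∖≡0⇒≐ {Z} {Z′} Z⊑Z′ none i = bool-ext (Z⊑Z′ i) back
    where
    back : Z′ i ≡ true → Z i ≡ true
    back Z′i with bool-cases (Z i)
    ... | inj₁ Zi = Zi
    ... | inj₂ Zi = ⊥-elim (true≢false (∧-intro Z′i (cong not Zi)) (cnt≡0⇒false none i))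

  cnt-⊑ : ∀ {Z Z′ : Fin k → Bool} → Z ⊑ Z′ → cnt Z′ ≡ cnt Z + cnt (Z′ ∖ Z)
  cnt-⊑ {Z} {Z′} Z⊑Z′ = trans (cnt-split Z′ Z) (cong (_+ cnt (Z′ ∖ Z)) (cnt-cong meet))
    where
    meet : ∀ i → Z′ i ∧ Z i ≡ Z i
    meet i with bool-cases (Z i)
    ... | inj₁ Zi rewrite Zi | Z⊑Z′ i Zi = refl
    ... | inj₂ Zi rewrite Zi = ∧-zeroʳ (Z′ i)

anyF-intro : ∀ {k} {f : Fin k → Bool} (i : Fin k) → f i ≡ true → anyF f ≡ true
anyF-intro {suc k} {f} fz     fi rewrite fi = refl
anyF-intro {suc k} {f} (fs i) fi = ∨-introʳ (f fz) (anyF-intro {f = λ j → f (fs j)} i fi)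

anyF-elim : ∀ {k} {f : Fin k → Bool} → anyF f ≡ true → ∃ λ i → f i ≡ true
anyF-elim {suc k} {f} p with ∨-elim {f fz} p
... | inj₁ f0 = fz , f0
... | inj₂ q with anyF-elim {f = λ j → f (fs j)} q
...   | i , fi = fs i , fi

anyF-false : ∀ {k} {f : Fin k → Bool} → (∀ i → f i ≡ false) → anyF f ≡ false
anyF-false h = ¬-not (λ p → let (i , fi) = anyF-elim p in true≢false fi (h i))

anyF-cong : ∀ {k} {f g : Fin k → Bool} → f ≐ g → anyF f ≡ anyF g
anyF-cong {zero}  _ = refl
anyF-cong {suc k} h rewrite h fz = cong (_ ∨_) (anyF-cong (λ i → h (fs i)))

least-witness : ∀ {k} (p : Fin k → Bool) (i : Fin k) → p i ≡ true →
                ∃ λ j → p j ≡ true × (∀ l → p l ≡ true → toℕ j ≤ toℕ l)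
least-witness {suc k} p i pi with bool-cases (p fz)
... | inj₁ p0 = fz , p0 , λ _ _ → z≤n
least-witness {suc k} p fz pi | inj₂ p0 = ⊥-elim (true≢false pi p0)
least-witness {suc k} p (fs i) pi | inj₂ p0 with least-witness (λ j → p (fs j)) i pi
... | j , pj , minimal = fs j , pj , below
  where
  below : ∀ l → p l ≡ true → toℕ (fs j) ≤ toℕ l
  below fz     pl = ⊥-elim (true≢false pl p0)
  below (fs l) pl = s≤s (minimal l pl)

size-cnt : ∀ {k} (p : Subset k) → ∣ p ∣ ≡ cnt (lookup p)
size-cnt []          = refl
size-cnt (true ∷ p)  = cong suc (size-cnt p)
size-cnt (false ∷ p) = size-cnt p

lookup-zipWith-⊤-∅ : ∀ {k} {g : Bool → Bool → Bool} (i : Fin k) → lookup (zipWith g ⊤ ∅) i ≡ g true false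
lookup-zipWith-⊤-∅ fz     = refl
lookup-zipWith-⊤-∅ (fs i) = lookup-zipWith-⊤-∅ i

lookup-⊤-x : ∀ {k} (j i : Fin k) → lookup (⊤ - j) i ≡ not ⌊ i ≟ j ⌋
lookup-⊤-x fz     fz     = refl
lookup-⊤-x fz     (fs i) = lookup-zipWith-⊤-∅ i
lookup-⊤-x (fs j) fz     = refl
lookup-⊤-x (fs j) (fs i) = trans (lookup-⊤-x j i) (cong not (sym (⌊⌋-map′ (cong fs) fs-injective (i ≟ j))))

m∸[n∸1]≡m+1∸n : ∀ m n → Fin n → m ∸ (n ∸ 1) ≡ m + 1 ∸ n
m∸[n∸1]≡m+1∸n m (suc n) _ = cong (_∸ suc n) (+-comm 1 m)

-- The bond rank d + (n − a) − (n − 1) of δ(A) exceeds s once a + s < d + 1.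
bond-rank-arith : ∀ {a s d n} → a + s + 1 ≤ d + 1 + 0 → a ≤ n → Fin n → s < d + (n ∸ a) ∸ (n ∸ 1)
bond-rank-arith {a} {s} {d} {suc k} h a≤n _ = begin-strict
  s                          <⟨ n<1+n s ⟩
  suc s                      ≡⟨ sym (m+n∸n≡m (suc s) k) ⟩
  suc s + k ∸ k              ≡⟨ cong (_∸ k) (sym (+-suc s k)) ⟩
  s + suc k ∸ k              ≡⟨ cong (λ z → s + z ∸ k) (sym (m+[n∸m]≡n a≤n)) ⟩
  s + (a + (suc k ∸ a)) ∸ k  ≡⟨ cong (_∸ k) (sym (+-assoc s a _)) ⟩
  s + a + (suc k ∸ a) ∸ k    ≤⟨ ∸-monoˡ-≤ k (+-monoˡ-≤ (suc k ∸ a) s+a≤d) ⟩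
  d + (suc k ∸ a) ∸ k        ∎
  where
  open ≤-Reasoning
  s+a≤d : s + a ≤ d
  s+a≤d = subst (_≤ d) (+-comm a s) (+-cancelʳ-≤ 1 (a + s) d (subst (a + s + 1 ≤_) (+-identityʳ (d + 1)) h))

module _ (G : Graph) where

  Vertex : Set
  Vertex = Fin (n G)

  Edge : Set
  Edge = Fin (m G)

  VertexSet : Set
  VertexSet = Vertex → Bool

  EdgeSet : Set
  EdgeSet = Edge → Bool

  end₁ end₂ : Edge → Vertex
  end₁ e = proj₁ (ends G e)
  end₂ e = proj₂ (ends G e)

  walk : EdgeSet → ℕ → Vertex → Vertex → Bool
  walk Z zero    u v = ⌊ u ≟ v ⌋
  walk Z (suc k) u v = walk Z k u v ∨
    anyF (λ e → Z e ∧ ((⌊ end₁ e ≟ v ⌋ ∧ walk Z k u (end₂ e)) ∨ (⌊ end₂ e ≟ v ⌋ ∧ walk Z k u (end₁ e))))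

  walk-cong : ∀ {Z Z′} → Z ≐ Z′ → ∀ k u v → walk Z k u v ≡ walk Z′ k u v
  walk-cong h zero    u v = refl
  walk-cong h (suc k) u v = cong₂ _∨_ (walk-cong h k u v)
    (anyF-cong (λ e → cong₂ _∧_ (h e) (cong₂ _∨_ (cong (⌊ end₁ e ≟ v ⌋ ∧_) (walk-cong h k u (end₂ e)))
                                                  (cong (⌊ end₂ e ≟ v ⌋ ∧_) (walk-cong h k u (end₁ e))))))

  reachW≡walk : ∀ Y k u v → reachW G Y k u v ≡ walk (lookup Y) k u v
  reachW≡walk Y zero    u v = refl
  reachW≡walk Y (suc k) u v = cong₂ _∨_ (reachW≡walk Y k u v)
    (anyF-cong (λ e → cong (lookup Y e ∧_) (cong₂ _∨_ (cong (⌊ end₁ e ≟ v ⌋ ∧_) (reachW≡walk Y k u (end₂ e)))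
                                                      (cong (⌊ end₂ e ≟ v ⌋ ∧_) (reachW≡walk Y k u (end₁ e))))))

  Traverses : Edge → Vertex → Vertex → Set
  Traverses e w v = (end₂ e ≡ w × end₁ e ≡ v) ⊎ (end₁ e ≡ w × end₂ e ≡ v)

  traverses-sym : ∀ {e w v} → Traverses e w v → Traverses e v w
  traverses-sym (inj₁ (p , q)) = inj₂ (q , p)
  traverses-sym (inj₂ (p , q)) = inj₁ (q , p)

  walk-weaken : ∀ {Z} k {u v} → walk Z k u v ≡ true → walk Z (suc k) u v ≡ true
  walk-weaken k p = ∨-introˡ _ p

  walk-step : ∀ {Z} k {u w v} e → Z e ≡ true → Traverses e w v →
              walk Z k u w ≡ true → walk Z (suc k) u v ≡ true
  walk-step {Z} k {u} {v = v} e Ze (inj₁ (refl , refl)) p =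
    ∨-introʳ (walk Z k u v) (anyF-intro e (∧-intro Ze (∨-introˡ _ (∧-intro (≟-refl (end₁ e)) p))))
  walk-step {Z} k {u} {v = v} e Ze (inj₂ (refl , refl)) p =
    ∨-introʳ (walk Z k u v) (anyF-intro e (∧-intro Ze
      (∨-introʳ (⌊ end₁ e ≟ end₂ e ⌋ ∧ walk Z k u (end₂ e)) (∧-intro (≟-refl (end₂ e)) p))))

  walk-suc-elim : ∀ {Z} k {u v} → walk Z (suc k) u v ≡ true →
                  walk Z k u v ≡ true ⊎ (∃ λ e → ∃ λ w → Z e ≡ true × Traverses e w v × walk Z k u w ≡ true)
  walk-suc-elim {Z} k {u} {v} p with ∨-elim {walk Z k u v} p
  ... | inj₁ q = inj₁ q
  ... | inj₂ q with anyF-elim q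
  ...   | e , r with ∧-elim r
  ...     | Ze , s with ∨-elim s
  ...       | inj₁ t = let (a , b) = ∧-elim t in inj₂ (e , end₂ e , Ze , inj₁ (refl , ≟-sound a) , b)
  ...       | inj₂ t = let (a , b) = ∧-elim t in inj₂ (e , end₁ e , Ze , inj₂ (refl , ≟-sound a) , b)

  walk-+ : ∀ {Z} j k {u v} → walk Z k u v ≡ true → walk Z (j + k) u v ≡ true
  walk-+ zero    k p = p
  walk-+ (suc j) k p = walk-weaken (j + k) (walk-+ j k p)

  walk-trans : ∀ {Z} j k {u v w} → walk Z j u v ≡ true → walk Z k v w ≡ true → walk Z (j + k) u w ≡ true
  walk-trans j zero p q rewrite ≟-sound q | +-identityʳ j = p
  walk-trans {Z} j (suc k) {u} {w = w} p q with walk-suc-elim k q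
  ... | inj₁ r = subst (λ l → walk Z l u w ≡ true) (sym (+-suc j k)) (walk-weaken (j + k) (walk-trans j k p r))
  ... | inj₂ (e , _ , Ze , t , r) =
    subst (λ l → walk Z l u w ≡ true) (sym (+-suc j k)) (walk-step (j + k) e Ze t (walk-trans j k p r))

  walk-mono : ∀ {Z Z′} → Z ⊑ Z′ → ∀ k {u v} → walk Z k u v ≡ true → walk Z′ k u v ≡ true
  walk-mono h zero    p = p
  walk-mono h (suc k) p with walk-suc-elim k p
  ... | inj₁ r = walk-weaken k (walk-mono h k r)
  ... | inj₂ (e , _ , Ze , t , r) = walk-step k e (h e Ze) t (walk-mono h k r)

  walk-sym : ∀ {Z} k {u v} → walk Z k u v ≡ true → walk Z k v u ≡ true
  walk-sym zero p rewrite ≟-sound p = ≟-refl _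
  walk-sym (suc k) {u} {v} p with walk-suc-elim k p
  ... | inj₁ r = walk-weaken k (walk-sym k r)
  ... | inj₂ (e , w , Ze , t , r) =
    walk-trans 1 k (walk-step 0 e Ze (traverses-sym t) (≟-refl v)) (walk-sym k r)

  Linked : EdgeSet → Vertex → Vertex → Set
  Linked Z u v = ∃ λ k → walk Z k u v ≡ true

  linked-refl : ∀ {Z} u → Linked Z u u
  linked-refl u = 0 , ≟-refl u

  linked-≡ : ∀ {Z u v} → u ≡ v → Linked Z u v
  linked-≡ refl = linked-refl _

  linked-sym : ∀ {Z u v} → Linked Z u v → Linked Z v u
  linked-sym (k , p) = k , walk-sym k p

  linked-trans : ∀ {Z u v w} → Linked Z u v → Linked Z v w → Linked Z u w
  linked-trans (j , p) (k , q) = j + k , walk-trans j k p q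

  linked-edge : ∀ {Z w v} e → Z e ≡ true → Traverses e w v → Linked Z w v
  linked-edge e Ze t = 1 , walk-step 0 e Ze t (≟-refl _)

  linked-mono : ∀ {Z Z′} → Z ⊑ Z′ → ∀ {u v} → Linked Z u v → Linked Z′ u v
  linked-mono h (k , p) = k , walk-mono h k p

  linked-ends : ∀ {Z e w v} → Traverses e w v → Linked Z w v → Linked Z (end₁ e) (end₂ e)
  linked-ends (inj₁ (refl , refl)) r = linked-sym r
  linked-ends (inj₂ (refl , refl)) r = r

  ends-linked : ∀ {Z e w v} → Traverses e w v → Linked Z (end₁ e) (end₂ e) → Linked Z w v
  ends-linked (inj₁ (refl , refl)) r = linked-sym r
  ends-linked (inj₂ (refl , refl)) r = r

  linked-closed : ∀ {Z} (S : VertexSet) →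
                  (∀ e w v → Z e ≡ true → Traverses e w v → S w ≡ true → S v ≡ true) →
                  ∀ {u v} → Linked Z u v → S u ≡ true → S v ≡ true
  linked-closed {Z} S closed {u} (k , p) Su = go k p
    where
    go : ∀ k {v} → walk Z k u v ≡ true → S v ≡ true
    go zero    p rewrite ≟-sound p = Su
    go (suc k) p with walk-suc-elim k p
    ... | inj₁ r = go k r
    ... | inj₂ (e , w , Ze , t , r) = closed e w _ Ze t (go k r)

  -- The layers walk Z k u either stop growing for good or gain a vertex at each step,
  -- so the layer of index n G already contains every vertex linked to u.
  module _ (Z : EdgeSet) (u : Vertex) where

    private
      layer : ℕ → VertexSet
      layer k = walk Z k u

      layer-suc-mono : ∀ j k → layer j ⊑ layer k → layer (suc j) ⊑ layer (suc k)
      layer-suc-mono j k h v p with walk-suc-elim j p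
      ... | inj₁ r = walk-weaken k (h v r)
      ... | inj₂ (e , w , Ze , t , r) = walk-step k e Ze t (h w r)

      layer-stable : ∀ k → layer (suc k) ⊑ layer k → ∀ j → layer j ⊑ layer k
      layer-stable k h zero    v p = subst (λ l → layer l v ≡ true) (+-identityʳ k) (walk-+ k 0 p)
      layer-stable k h (suc j) v p = h v (layer-suc-mono j k (layer-stable k h j) v p)

      layer-stable-or-large : ∀ k → (∀ j → layer j ⊑ layer k) ⊎ k < cnt (layer k)
      layer-stable-or-large zero = inj₂ (cnt-pos u (≟-refl u))
      layer-stable-or-large (suc k) with layer-stable-or-large k
      ... | inj₁ stable = inj₁ (λ j v p → walk-weaken k (stable j v p))
      ... | inj₂ large with bool-cases (anyF (layer (suc k) ∖ layer k))
      ...   | inj₁ grows = let (v , q) = anyF-elim grows ; (a , b) = ∧-elim q in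
              inj₂ (≤-trans (s≤s large) (cnt-mono-< {f = layer k} (λ _ → walk-weaken k) v a (not-injective b)))
      ...   | inj₂ stops = inj₁ (λ j v p → walk-weaken k (layer-stable k no-growth j v p))
        where
        no-growth : layer (suc k) ⊑ layer k
        no-growth v p with bool-cases (layer k v)
        ... | inj₁ q = q
        ... | inj₂ q = ⊥-elim (true≢false (anyF-intro {f = layer (suc k) ∖ layer k} v (∧-intro p (cong not q))) stops)

    linked⇒walk : ∀ {v} → Linked Z u v → walk Z (n G) u v ≡ true
    linked⇒walk {v} (k , p) with layer-stable-or-large (n G)
    ... | inj₁ stable = stable k v p
    ... | inj₂ large  = ⊥-elim (<-irrefl refl (≤-trans large (cnt≤ (layer (n G)))))

  reach⇒linked : ∀ Y {Z} → lookup Y ≐ Z → ∀ u v → Reach G Y u v ≡ true → Linked Z u v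
  reach⇒linked Y Y≐Z u v p = n G , trans (sym (walk-cong Y≐Z (n G) u v)) (trans (sym (reachW≡walk Y (n G) u v)) p)

  isRoot : EdgeSet → Vertex → Bool
  isRoot Z v = not (anyF (λ u → (toℕ u <ᵇ toℕ v) ∧ walk Z (n G) u v))

  #comp : EdgeSet → ℕ
  #comp Z = cnt (isRoot Z)

  components≡#comp : ∀ Y → components G Y ≡ #comp (lookup Y)
  components≡#comp Y =
    cnt-cong (λ v → cong not (anyF-cong (λ u → cong ((toℕ u <ᵇ toℕ v) ∧_) (reachW≡walk Y (n G) u v))))

  #comp-cong : ∀ {Z Z′} → Z ≐ Z′ → #comp Z ≡ #comp Z′
  #comp-cong h = cnt-cong (λ v → cong not (anyF-cong (λ u → cong ((toℕ u <ᵇ toℕ v) ∧_) (walk-cong h (n G) u v))))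

  isRoot-minimal : ∀ {Z v} → isRoot Z v ≡ true → ∀ u → toℕ u < toℕ v → ¬ Linked Z u v
  isRoot-minimal {Z} {v} p u u<v r =
    true≢false (anyF-intro {f = λ u → (toℕ u <ᵇ toℕ v) ∧ walk Z (n G) u v} u
                  (∧-intro (<ᵇ-complete u<v) (linked⇒walk Z u r)))
               (not-injective p)

  minimal-isRoot : ∀ {Z v} → (∀ u → toℕ u < toℕ v → ¬ Linked Z u v) → isRoot Z v ≡ true
  minimal-isRoot h = cong not (anyF-false (λ u → ¬-not (λ q →
    let (a , b) = ∧-elim q in h u (<ᵇ-sound a) (n G , b))))

  isRoot-cong : ∀ {Z Z′ v} → (∀ {u w} → Linked Z u w → Linked Z′ u w) →
                (∀ {u w} → Linked Z′ u w → Linked Z u w) → isRoot Z v ≡ isRoot Z′ v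
  isRoot-cong to from =
    bool-ext (λ p → minimal-isRoot (λ u u<v r → isRoot-minimal p u u<v (from r)))
             (λ p → minimal-isRoot (λ u u<v r → isRoot-minimal p u u<v (to r)))

  private
    least-linked : (Z : EdgeSet) (a : Vertex) →
                   ∃ λ r → walk Z (n G) r a ≡ true × (∀ u → walk Z (n G) u a ≡ true → toℕ r ≤ toℕ u)
    least-linked Z a = least-witness (λ u → walk Z (n G) u a) a (linked⇒walk Z a (linked-refl a))

  rep : EdgeSet → Vertex → Vertex
  rep Z a = proj₁ (least-linked Z a)

  rep-linked : ∀ Z a → Linked Z (rep Z a) a
  rep-linked Z a = n G , proj₁ (proj₂ (least-linked Z a))

  rep-minimal : ∀ Z a u → Linked Z u a → toℕ (rep Z a) ≤ toℕ u
  rep-minimal Z a u r = proj₂ (proj₂ (least-linked Z a)) u (linked⇒walk Z u r)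

  rep-isRoot : ∀ Z a → isRoot Z (rep Z a) ≡ true
  rep-isRoot Z a = minimal-isRoot (λ u u<r r →
    <-irrefl refl (<-≤-trans u<r (rep-minimal Z a u (linked-trans r (rep-linked Z a)))))

  isRoot-unique : ∀ {Z v w} → isRoot Z v ≡ true → isRoot Z w ≡ true → Linked Z v w → v ≡ w
  isRoot-unique {v = v} {w} rv rw r with <-cmp (toℕ v) (toℕ w)
  ... | tri< v<w _ _ = ⊥-elim (isRoot-minimal rw v v<w r)
  ... | tri≈ _ v≡w _ = toℕ-injective v≡w
  ... | tri> _ _ w<v = ⊥-elim (isRoot-minimal rv w w<v (linked-sym r))

  LinkedVia : EdgeSet → Vertex → Vertex → Vertex → Vertex → Set
  LinkedVia Z a b u v = Linked Z u v ⊎ (Linked Z u a × Linked Z b v) ⊎ (Linked Z u b × Linked Z a v)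

  linkedVia-extend : ∀ {Z a b u w v} → LinkedVia Z a b u w → Linked Z w v → LinkedVia Z a b u v
  linkedVia-extend (inj₁ p)              q = inj₁ (linked-trans p q)
  linkedVia-extend (inj₂ (inj₁ (p , r))) q = inj₂ (inj₁ (p , linked-trans r q))
  linkedVia-extend (inj₂ (inj₂ (p , r))) q = inj₂ (inj₂ (p , linked-trans r q))

  linkedVia-cross : ∀ {Z a b u} → LinkedVia Z a b u a → LinkedVia Z a b u b
  linkedVia-cross (inj₁ p)              = inj₂ (inj₁ (p , linked-refl _))
  linkedVia-cross (inj₂ (inj₁ (p , _))) = inj₂ (inj₁ (p , linked-refl _))
  linkedVia-cross (inj₂ (inj₂ (p , _))) = inj₁ p

  linkedVia-cross′ : ∀ {Z a b u} → LinkedVia Z a b u b → LinkedVia Z a b u a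
  linkedVia-cross′ (inj₁ p)              = inj₂ (inj₂ (p , linked-refl _))
  linkedVia-cross′ (inj₂ (inj₁ (p , _))) = inj₁ p
  linkedVia-cross′ (inj₂ (inj₂ (p , _))) = inj₂ (inj₂ (p , linked-refl _))

  linkedVia-swap : ∀ {Z a b u v} → LinkedVia Z a b u v → LinkedVia Z b a u v
  linkedVia-swap (inj₁ p)        = inj₁ p
  linkedVia-swap (inj₂ (inj₁ p)) = inj₂ (inj₂ p)
  linkedVia-swap (inj₂ (inj₂ p)) = inj₂ (inj₁ p)

  linked-∪⁅⁆-elim : ∀ Z e {u v} → Linked (Z ∪ ⁅ e ⁆) u v → LinkedVia Z (end₁ e) (end₂ e) u v
  linked-∪⁅⁆-elim Z e {u} (k , p) = go k p
    where
    go : ∀ k {v} → walk (Z ∪ ⁅ e ⁆) k u v ≡ true → LinkedVia Z (end₁ e) (end₂ e) u v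
    go zero p rewrite ≟-sound p = inj₁ (linked-refl _)
    go (suc k) p with walk-suc-elim k p
    ... | inj₁ r = go k r
    ... | inj₂ (e′ , w , Ze′ , t , r) with ∪⁅⁆-elim Z e Ze′
    ...   | inj₁ z = linkedVia-extend (go k r) (linked-edge e′ z t)
    ...   | inj₂ refl with t
    ...     | inj₁ (refl , refl) = linkedVia-cross′ (go k r)
    ...     | inj₂ (refl , refl) = linkedVia-cross (go k r)

  -- The roots of Z and Z′ agree except at rep Z b, which is no root of Z′ since rep Z a precedes it.
  #comp-merge : ∀ Z Z′ a b → (∀ {u v} → Linked Z u v → Linked Z′ u v) →
                (∀ {u v} → Linked Z′ u v → LinkedVia Z a b u v) →
                Linked Z′ a b → toℕ (rep Z a) < toℕ (rep Z b) → #comp Z ≡ suc (#comp Z′)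
  #comp-merge Z Z′ a b up down ab ra<rb = cnt-suc-at (rep Z b) same (rep-isRoot Z b) rb-not-root
    where
    rb-not-root : isRoot Z′ (rep Z b) ≡ false
    rb-not-root = ¬-not (λ p → isRoot-minimal p (rep Z a) ra<rb
      (linked-trans (up (rep-linked Z a)) (linked-trans ab (up (linked-sym (rep-linked Z b))))))
    same : ∀ v → v ≢ rep Z b → isRoot Z v ≡ isRoot Z′ v
    same v v≢rb = bool-ext to (λ p → minimal-isRoot (λ u u<v r → isRoot-minimal p u u<v (up r)))
      where
      to : isRoot Z v ≡ true → isRoot Z′ v ≡ true
      to p = minimal-isRoot no-smaller
        where
        no-smaller : ∀ u → toℕ u < toℕ v → ¬ Linked Z′ u v
        no-smaller u u<v r with down r
        ... | inj₁ q = isRoot-minimal p u u<v q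
        ... | inj₂ (inj₁ (_ , q)) = v≢rb (sym (isRoot-unique (rep-isRoot Z b) p (linked-trans (rep-linked Z b) q)))
        ... | inj₂ (inj₂ (q , s)) with isRoot-unique (rep-isRoot Z a) p (linked-trans (rep-linked Z a) s)
        ...   | refl = <-irrefl refl (<-trans ra<rb (≤-<-trans (rep-minimal Z b u q) u<v))

  #comp-∪⁅⁆-linked : ∀ Z e → Linked Z (end₁ e) (end₂ e) → #comp (Z ∪ ⁅ e ⁆) ≡ #comp Z
  #comp-∪⁅⁆-linked Z e linked =
    cnt-cong {f = isRoot (Z ∪ ⁅ e ⁆)} {isRoot Z} (λ v → isRoot-cong {v = v} down (linked-mono (⊑-∪ Z ⁅ e ⁆)))
    where
    down : ∀ {u w} → Linked (Z ∪ ⁅ e ⁆) u w → Linked Z u w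
    down r with linked-∪⁅⁆-elim Z e r
    ... | inj₁ q = q
    ... | inj₂ (inj₁ (q , s)) = linked-trans q (linked-trans linked s)
    ... | inj₂ (inj₂ (q , s)) = linked-trans q (linked-trans (linked-sym linked) s)

  #comp-∪⁅⁆-unlinked : ∀ Z e → ¬ Linked Z (end₁ e) (end₂ e) → #comp Z ≡ suc (#comp (Z ∪ ⁅ e ⁆))
  #comp-∪⁅⁆-unlinked Z e unlinked with <-cmp (toℕ (rep Z (end₁ e))) (toℕ (rep Z (end₂ e)))
  ... | tri< lt _ _ = #comp-merge Z (Z ∪ ⁅ e ⁆) (end₁ e) (end₂ e) (linked-mono (⊑-∪ Z ⁅ e ⁆))
                        (linked-∪⁅⁆-elim Z e) (linked-edge e (∪⁅⁆-new Z e) (inj₂ (refl , refl))) lt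
  ... | tri> _ _ gt = #comp-merge Z (Z ∪ ⁅ e ⁆) (end₂ e) (end₁ e) (linked-mono (⊑-∪ Z ⁅ e ⁆))
                        (linkedVia-swap ∘ linked-∪⁅⁆-elim Z e)
                        (linked-edge e (∪⁅⁆-new Z e) (inj₁ (refl , refl))) gt
  ... | tri≈ _ eq _ = ⊥-elim (unlinked (linked-trans (linked-sym (rep-linked Z (end₁ e)))
                        (subst (λ r → Linked Z r (end₂ e)) (sym (toℕ-injective eq)) (rep-linked Z (end₂ e)))))

  linked? : ∀ Z u v → Linked Z u v ⊎ ¬ Linked Z u v
  linked? Z u v with bool-cases (walk Z (n G) u v)
  ... | inj₁ p = inj₁ (n G , p)
  ... | inj₂ p = inj₂ (λ r → true≢false (linked⇒walk Z u r) p)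

  #comp-∪⁅⁆-≤ : ∀ Z e → #comp (Z ∪ ⁅ e ⁆) ≤ #comp Z
  #comp-∪⁅⁆-≤ Z e with linked? Z (end₁ e) (end₂ e)
  ... | inj₁ linked   = ≤-reflexive (#comp-∪⁅⁆-linked Z e linked)
  ... | inj₂ unlinked = subst (#comp (Z ∪ ⁅ e ⁆) ≤_) (sym (#comp-∪⁅⁆-unlinked Z e unlinked)) (n≤1+n _)

  #comp-≤-∪⁅⁆ : ∀ Z e → #comp Z ≤ suc (#comp (Z ∪ ⁅ e ⁆))
  #comp-≤-∪⁅⁆ Z e with linked? Z (end₁ e) (end₂ e)
  ... | inj₁ linked   = ≤-trans (≤-reflexive (sym (#comp-∪⁅⁆-linked Z e linked))) (n≤1+n _)
  ... | inj₂ unlinked = ≤-reflexive (#comp-∪⁅⁆-unlinked Z e unlinked)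

  #comp-∖⁅⁆-linked : ∀ Z e → Z e ≡ true → Linked (Z ∖ ⁅ e ⁆) (end₁ e) (end₂ e) →
                     #comp (Z ∖ ⁅ e ⁆) ≡ #comp Z
  #comp-∖⁅⁆-linked Z e Ze linked =
    trans (sym (#comp-∪⁅⁆-linked (Z ∖ ⁅ e ⁆) e linked)) (#comp-cong (∖⁅⁆-∪⁅⁆ Z e Ze))

  #comp-≤-+∖ : ∀ {Z Z′} → Z ⊑ Z′ → #comp Z ≤ #comp Z′ + cnt (Z′ ∖ Z)
  #comp-≤-+∖ Z⊑Z′ = go _ Z⊑Z′ refl
    where
    go : ∀ d {Z Z′} → Z ⊑ Z′ → cnt (Z′ ∖ Z) ≡ d → #comp Z ≤ #comp Z′ + d
    go zero Z⊑Z′ none = ≤-reflexive (trans (#comp-cong (⊑-∖≡0⇒≐ Z⊑Z′ none)) (sym (+-identityʳ _)))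
    go (suc d) {Z} {Z′} Z⊑Z′ extra with cnt-pos⇒∃ (Z′ ∖ Z) (subst (1 ≤_) (sym extra) (s≤s z≤n))
    ... | e , p = begin
          #comp Z                        ≤⟨ go d Z⊑Z″ fewer ⟩
          #comp Z″ + d                   ≤⟨ +-monoˡ-≤ d (#comp-≤-∪⁅⁆ Z″ e) ⟩
          suc (#comp (Z″ ∪ ⁅ e ⁆)) + d   ≡⟨ cong (λ c → suc c + d) (#comp-cong (∖⁅⁆-∪⁅⁆ Z′ e Z′e)) ⟩
          suc (#comp Z′) + d             ≡⟨ sym (+-suc (#comp Z′) d) ⟩
          #comp Z′ + suc d               ∎
      where
      open ≤-Reasoning
      Z′e : Z′ e ≡ true
      Z′e = proj₁ (∧-elim p)
      Z″ : EdgeSet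
      Z″ = Z′ ∖ ⁅ e ⁆
      Z⊑Z″ : Z ⊑ Z″
      Z⊑Z″ e′ Ze′ with e′ ≟ e
      ... | yes refl = ⊥-elim (true≢false Ze′ (not-injective (proj₂ (∧-elim p))))
      ... | no _     = ∧-intro (Z⊑Z′ e′ Ze′) refl
      fewer : cnt (Z″ ∖ Z) ≡ d
      fewer = suc-injective (trans (sym (trans (cnt-∖⁅⁆ (Z′ ∖ Z) e p) (cong suc (cnt-cong (∖-swap Z′ Z ⁅ e ⁆))))) extra)

  #comp-∅ : #comp (λ _ → false) ≡ n G
  #comp-∅ = trans (cnt-cong {f = isRoot (λ _ → false)} {λ _ → true}
                    (λ v → minimal-isRoot {v = v} (λ u u<v r → <-irrefl (cong toℕ (isolated r)) u<v)))
                  cnt-true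
    where
    isolated : ∀ {u v} → Linked (λ _ → false) u v → u ≡ v
    isolated {u} r = sym (≟-sound (linked-closed ⁅ u ⁆ (λ _ _ _ ()) r (≟-refl u)))

  n≤#comp+cnt : ∀ Z → n G ≤ #comp Z + cnt Z
  n≤#comp+cnt Z = subst₂ _≤_ #comp-∅ (cong (#comp Z +_) (cnt-cong (λ e → ∧-identityʳ (Z e))))
                    (#comp-≤-+∖ {λ _ → false} {Z} (λ _ ()))

  #comp-connected : Vertex → ∀ Z → (∀ u v → Linked Z u v) → #comp Z ≡ 1
  #comp-connected a Z connected =
    trans (cnt-suc-at (rep Z a) other-not-root (rep-isRoot Z a) refl) (cong suc (cnt-false {n G} {λ _ → false} (λ _ → refl)))
    where
    other-not-root : ∀ v → v ≢ rep Z a → isRoot Z v ≡ false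
    other-not-root v v≢r = ¬-not (λ p → v≢r (isRoot-unique p (rep-isRoot Z a) (connected v (rep Z a))))

  Incident : Edge → Vertex → Set
  Incident e v = end₁ e ≡ v ⊎ end₂ e ≡ v

  δᶠ : VertexSet → EdgeSet
  δᶠ A e = A (end₁ e) ∨ A (end₂ e)

  δᶠ-incident : ∀ A e v → A v ≡ true → Incident e v → δᶠ A e ≡ true
  δᶠ-incident A e v Av (inj₁ refl) = ∨-introˡ _ Av
  δᶠ-incident A e v Av (inj₂ refl) = ∨-introʳ (A (end₁ e)) Av

  δᶠ-mono : ∀ {A B} → A ⊑ B → δᶠ A ⊑ δᶠ B
  δᶠ-mono {A} A⊑B e p with ∨-elim {A (end₁ e)} p
  ... | inj₁ q = ∨-introˡ _ (A⊑B _ q)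
  ... | inj₂ q = ∨-introʳ _ (A⊑B _ q)

  -- In the subgraph (V, Y) the bond rank of Y ∩ δ(A) is |Y ∩ δ(A)| + c(Y) − c(Y ∖ δ(A)), with c the
  -- number of components; Loose Y A s says that it exceeds |A| − s.  For Y = E and s = 0 it is ¬ Tight A.
  Loose : EdgeSet → VertexSet → ℕ → Set
  Loose Y A s = #comp (Y ∖ δᶠ A) + cnt A + 1 ≤ cnt (Y ∩ δᶠ A) + #comp Y + s

  loose-cong : ∀ {Y Y′} A s → Y ≐ Y′ → Loose Y A s → Loose Y′ A s
  loose-cong A s Y≐Y′ = subst₂ (λ a b → a + cnt A + 1 ≤ b)
    (#comp-cong (λ e → cong (_∧ not (δᶠ A e)) (Y≐Y′ e)))
    (cong₂ (λ d c → d + c + s) (cnt-cong (λ e → cong (_∧ δᶠ A e) (Y≐Y′ e))) (#comp-cong Y≐Y′))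

  cnt-∩δ-∪⁅⁆ : ∀ Y A e → Y e ≡ false → δᶠ A e ≡ true → cnt ((Y ∪ ⁅ e ⁆) ∩ δᶠ A) ≡ suc (cnt (Y ∩ δᶠ A))
  cnt-∩δ-∪⁅⁆ Y A e e∉Y inside =
    trans (cnt-cong (∪⁅⁆-∩-inside Y (δᶠ A) e inside)) (cnt-∪⁅⁆ (Y ∩ δᶠ A) e (cong (_∧ δᶠ A e) e∉Y))

  loose-∪⁅⁆-δ : ∀ Y A s e → Y e ≡ false → δᶠ A e ≡ true → Loose Y A s → Loose (Y ∪ ⁅ e ⁆) A s
  loose-∪⁅⁆-δ Y A s e e∉Y inside loose = begin
    #comp (Y′ ∖ δᶠ A) + cnt A + 1            ≡⟨ cong (λ a → a + cnt A + 1) (#comp-cong (∪⁅⁆-∖-inside Y (δᶠ A) e inside)) ⟩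
    #comp (Y ∖ δᶠ A) + cnt A + 1             ≤⟨ loose ⟩
    cnt (Y ∩ δᶠ A) + #comp Y + s             ≤⟨ +-monoˡ-≤ s (+-monoʳ-≤ (cnt (Y ∩ δᶠ A)) (#comp-≤-∪⁅⁆ Y e)) ⟩
    cnt (Y ∩ δᶠ A) + suc (#comp Y′) + s      ≡⟨ cong (_+ s) (+-suc (cnt (Y ∩ δᶠ A)) _) ⟩
    suc (cnt (Y ∩ δᶠ A)) + #comp Y′ + s      ≡⟨ cong (λ d → d + #comp Y′ + s) (sym (cnt-∩δ-∪⁅⁆ Y A e e∉Y inside)) ⟩
    cnt (Y′ ∩ δᶠ A) + #comp Y′ + s           ∎
    where
    open ≤-Reasoning
    Y′ : EdgeSet
    Y′ = Y ∪ ⁅ e ⁆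

  loose-∪⁅⁆-linked : ∀ Y A s e → δᶠ A e ≡ false → Linked Y (end₁ e) (end₂ e) → Loose Y A s → Loose (Y ∪ ⁅ e ⁆) A s
  loose-∪⁅⁆-linked Y A s e outside linked loose = begin
    #comp (Y′ ∖ δᶠ A) + cnt A + 1            ≡⟨ cong (λ a → a + cnt A + 1) (#comp-cong (∪⁅⁆-∖-outside Y (δᶠ A) e outside)) ⟩
    #comp ((Y ∖ δᶠ A) ∪ ⁅ e ⁆) + cnt A + 1   ≤⟨ +-monoˡ-≤ 1 (+-monoˡ-≤ (cnt A) (#comp-∪⁅⁆-≤ (Y ∖ δᶠ A) e)) ⟩
    #comp (Y ∖ δᶠ A) + cnt A + 1             ≤⟨ loose ⟩
    cnt (Y ∩ δᶠ A) + #comp Y + s             ≡⟨ cong₂ (λ d c → d + c + s) (sym (cnt-cong (∪⁅⁆-∩-outside Y (δᶠ A) e outside)))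
                                                                        (sym (#comp-∪⁅⁆-linked Y e linked)) ⟩
    cnt (Y′ ∩ δᶠ A) + #comp Y′ + s           ∎
    where
    open ≤-Reasoning
    Y′ : EdgeSet
    Y′ = Y ∪ ⁅ e ⁆

  loose-∪⁅⁆-unlinked : ∀ Y A s e → δᶠ A e ≡ false → ¬ Linked Y (end₁ e) (end₂ e) → Loose Y A s → Loose (Y ∪ ⁅ e ⁆) A s
  loose-∪⁅⁆-unlinked Y A s e outside unlinked loose = ≤-pred (begin
    suc (#comp (Y′ ∖ δᶠ A) + cnt A + 1)           ≡⟨ cong (λ a → suc (a + cnt A + 1)) (#comp-cong (∪⁅⁆-∖-outside Y (δᶠ A) e outside)) ⟩
    suc (#comp ((Y ∖ δᶠ A) ∪ ⁅ e ⁆)) + cnt A + 1  ≡⟨ cong (λ a → a + cnt A + 1) (sym (#comp-∪⁅⁆-unlinked (Y ∖ δᶠ A) e unlinked′)) ⟩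
    #comp (Y ∖ δᶠ A) + cnt A + 1                  ≤⟨ loose ⟩
    cnt (Y ∩ δᶠ A) + #comp Y + s                  ≡⟨ cong₂ (λ d c → d + c + s) (sym (cnt-cong (∪⁅⁆-∩-outside Y (δᶠ A) e outside)))
                                                                             (#comp-∪⁅⁆-unlinked Y e unlinked) ⟩
    cnt (Y′ ∩ δᶠ A) + suc (#comp Y′) + s          ≡⟨ cong (_+ s) (+-suc (cnt (Y′ ∩ δᶠ A)) _) ⟩
    suc (cnt (Y′ ∩ δᶠ A) + #comp Y′ + s)          ∎)
    where
    open ≤-Reasoning
    Y′ : EdgeSet
    Y′ = Y ∪ ⁅ e ⁆
    unlinked′ : ¬ Linked (Y ∖ δᶠ A) (end₁ e) (end₂ e)
    unlinked′ r = unlinked (linked-mono (λ i p → proj₁ (∧-elim p)) r)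

  loose-∪⁅⁆ : ∀ Y A s e → Loose Y A s → Loose (Y ∪ ⁅ e ⁆) A s
  loose-∪⁅⁆ Y A s e with bool-cases (Y e) | bool-cases (δᶠ A e) | linked? Y (end₁ e) (end₂ e)
  ... | inj₁ e∈Y | _            | _             = loose-cong A s (λ i → sym (∪⁅⁆-present Y e e∈Y i))
  ... | inj₂ e∉Y | inj₁ inside  | _             = loose-∪⁅⁆-δ Y A s e e∉Y inside
  ... | inj₂ _   | inj₂ outside | inj₁ linked   = loose-∪⁅⁆-linked Y A s e outside linked
  ... | inj₂ _   | inj₂ outside | inj₂ unlinked = loose-∪⁅⁆-unlinked Y A s e outside unlinked

  loose-mono : ∀ {Y Y′} A s → Y ⊑ Y′ → Loose Y A s → Loose Y′ A s
  loose-mono A s Y⊑Y′ = go _ Y⊑Y′ refl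
    where
    go : ∀ d {Y Y′} → Y ⊑ Y′ → cnt (Y′ ∖ Y) ≡ d → Loose Y A s → Loose Y′ A s
    go zero Y⊑Y′ none = loose-cong A s (⊑-∖≡0⇒≐ Y⊑Y′ none)
    go (suc d) {Y} {Y′} Y⊑Y′ extra loose with cnt-pos⇒∃ (Y′ ∖ Y) (subst (1 ≤_) (sym extra) (s≤s z≤n))
    ... | e , p = go d Y∪e⊑Y′ fewer (loose-∪⁅⁆ Y A s e loose)
      where
      Y∪e⊑Y′ : Y ∪ ⁅ e ⁆ ⊑ Y′
      Y∪e⊑Y′ e′ q with ∨-elim {Y e′} q
      ... | inj₁ Ye′ = Y⊑Y′ e′ Ye′
      ... | inj₂ e′≡e rewrite ≟-sound e′≡e = proj₁ (∧-elim p)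
      fewer : cnt (Y′ ∖ (Y ∪ ⁅ e ⁆)) ≡ d
      fewer = suc-injective (trans (sym (trans (cnt-∖⁅⁆ (Y′ ∖ Y) e p) (cong suc (cnt-cong (∖-∖ Y′ Y ⁅ e ⁆))))) extra)

  loose-∪⁅⁆-chord-δ : ∀ Y A s e → Y e ≡ false → δᶠ A e ≡ true → Linked Y (end₁ e) (end₂ e) →
                      Loose Y A (suc s) → Loose (Y ∪ ⁅ e ⁆) A s
  loose-∪⁅⁆-chord-δ Y A s e e∉Y inside linked loose = begin
    #comp (Y′ ∖ δᶠ A) + cnt A + 1        ≡⟨ cong (λ a → a + cnt A + 1) (#comp-cong (∪⁅⁆-∖-inside Y (δᶠ A) e inside)) ⟩
    #comp (Y ∖ δᶠ A) + cnt A + 1         ≤⟨ loose ⟩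
    cnt (Y ∩ δᶠ A) + #comp Y + suc s     ≡⟨ +-suc _ s ⟩
    suc (cnt (Y ∩ δᶠ A)) + #comp Y + s   ≡⟨ cong₂ (λ d c → d + c + s) (sym (cnt-∩δ-∪⁅⁆ Y A e e∉Y inside))
                                                                    (sym (#comp-∪⁅⁆-linked Y e linked)) ⟩
    cnt (Y′ ∩ δᶠ A) + #comp Y′ + s       ∎
    where
    open ≤-Reasoning
    Y′ : EdgeSet
    Y′ = Y ∪ ⁅ e ⁆

  loose-∪⁅⁆-chord-¬δ : ∀ Y A s e → δᶠ A e ≡ false → Linked Y (end₁ e) (end₂ e) →
                       ¬ Linked (Y ∖ δᶠ A) (end₁ e) (end₂ e) → Loose Y A (suc s) → Loose (Y ∪ ⁅ e ⁆) A s
  loose-∪⁅⁆-chord-¬δ Y A s e outside linked unlinked loose = ≤-pred (begin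
    suc (#comp (Y′ ∖ δᶠ A) + cnt A + 1)           ≡⟨ cong (λ a → suc (a + cnt A + 1)) (#comp-cong (∪⁅⁆-∖-outside Y (δᶠ A) e outside)) ⟩
    suc (#comp ((Y ∖ δᶠ A) ∪ ⁅ e ⁆)) + cnt A + 1  ≡⟨ cong (λ a → a + cnt A + 1) (sym (#comp-∪⁅⁆-unlinked (Y ∖ δᶠ A) e unlinked)) ⟩
    #comp (Y ∖ δᶠ A) + cnt A + 1                  ≤⟨ loose ⟩
    cnt (Y ∩ δᶠ A) + #comp Y + suc s              ≡⟨ cong₂ (λ d c → d + c + suc s) (sym (cnt-cong (∪⁅⁆-∩-outside Y (δᶠ A) e outside)))
                                                                                 (sym (#comp-∪⁅⁆-linked Y e linked)) ⟩
    cnt (Y′ ∩ δᶠ A) + #comp Y′ + suc s            ≡⟨ +-suc _ s ⟩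
    suc (cnt (Y′ ∩ δᶠ A) + #comp Y′ + s)          ∎)
    where
    open ≤-Reasoning
    Y′ : EdgeSet
    Y′ = Y ∪ ⁅ e ⁆

  NonBridgeAt : EdgeSet → Vertex → Set
  NonBridgeAt Y x = ∃ λ e → Y e ≡ true × Incident e x × Linked (Y ∖ ⁅ e ⁆) (end₁ e) (end₂ e)

  -- Y ∖ δ(A) arises from Y ∖ {e₀}, which has as many components as Y, by deleting the j other
  -- edges of Y ∩ δ(A).
  loose-⁅⁆ : ∀ Y A x → A x ≡ true → cnt A ≡ 1 → NonBridgeAt Y x → Loose Y A 1
  loose-⁅⁆ Y A x Ax |A|≡1 (e₀ , Ye₀ , e₀x , nonbridge) = begin
    #comp (Y ∖ δᶠ A) + cnt A + 1         ≡⟨ cong (λ a → #comp (Y ∖ δᶠ A) + a + 1) |A|≡1 ⟩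
    #comp (Y ∖ δᶠ A) + 1 + 1             ≤⟨ +-monoˡ-≤ 1 (+-monoˡ-≤ 1 fewer) ⟩
    #comp Y + j + 1 + 1                  ≡⟨ rearrange (#comp Y) j ⟩
    suc j + #comp Y + 1                  ≡⟨ cong (λ d → d + #comp Y + 1) (sym across) ⟩
    cnt (Y ∩ δᶠ A) + #comp Y + 1         ∎
    where
    open ≤-Reasoning
    open +-*-Solver
    e₀∈δ : δᶠ A e₀ ≡ true
    e₀∈δ = δᶠ-incident A e₀ x Ax e₀x
    j : ℕ
    j = cnt ((Y ∖ ⁅ e₀ ⁆) ∖ (Y ∖ δᶠ A))
    fewer : #comp (Y ∖ δᶠ A) ≤ #comp Y + j
    fewer = subst (λ c → #comp (Y ∖ δᶠ A) ≤ c + j) (#comp-∖⁅⁆-linked Y e₀ Ye₀ nonbridge)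
              (#comp-≤-+∖ (∖-antitoneʳ Y (λ e p → subst (λ e′ → δᶠ A e′ ≡ true) (sym (≟-sound p)) e₀∈δ)))
    across : cnt (Y ∩ δᶠ A) ≡ suc j
    across = trans (cnt-∖⁅⁆ (Y ∩ δᶠ A) e₀ (∧-intro Ye₀ e₀∈δ)) (cong suc (cnt-cong (∩-∖-comm Y (δᶠ A) ⁅ e₀ ⁆)))
    rearrange : ∀ c j → c + j + 1 + 1 ≡ suc j + c + 1
    rearrange = solve 2 (λ c j → c :+ j :+ con 1 :+ con 1 := (con 1 :+ j) :+ c :+ con 1) refl

  -- Y ∩ δ(A) has k more edges than Y ∩ δ(A ∖ {x}); deleting them from Y ∖ δ(A ∖ {x}) leaves Y ∖ δ(A)
  -- and adds at most k components.
  loose-add-vertex : ∀ Y A s x → A x ≡ true → Loose Y (A ∖ ⁅ x ⁆) s → Loose Y A (suc s)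
  loose-add-vertex Y A s x Ax loose′ = begin
    #comp (Y ∖ δᶠ A) + cnt A + 1                     ≤⟨ +-monoˡ-≤ 1 (+-mono-≤ fewer (≤-reflexive size)) ⟩
    (#comp (Y ∖ δᶠ A′) + k) + suc (cnt A′) + 1       ≡⟨ rearrange₁ (#comp (Y ∖ δᶠ A′)) k (cnt A′) ⟩
    (#comp (Y ∖ δᶠ A′) + cnt A′ + 1) + (k + 1)       ≤⟨ +-monoˡ-≤ (k + 1) loose′ ⟩
    (cnt (Y ∩ δᶠ A′) + #comp Y + s) + (k + 1)        ≡⟨ rearrange₂ (cnt (Y ∩ δᶠ A′)) (#comp Y) s k ⟩
    (cnt (Y ∩ δᶠ A′) + k) + #comp Y + suc s          ≡⟨ cong (λ d → d + #comp Y + suc s) (sym across) ⟩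
    cnt (Y ∩ δᶠ A) + #comp Y + suc s                 ∎
    where
    open ≤-Reasoning
    open +-*-Solver
    A′ : VertexSet
    A′ = A ∖ ⁅ x ⁆
    δA′⊑δA : δᶠ A′ ⊑ δᶠ A
    δA′⊑δA = δᶠ-mono {A′} {A} (λ v p → proj₁ (∧-elim p))
    k : ℕ
    k = cnt ((Y ∖ δᶠ A′) ∖ (Y ∖ δᶠ A))
    fewer : #comp (Y ∖ δᶠ A) ≤ #comp (Y ∖ δᶠ A′) + k
    fewer = #comp-≤-+∖ (∖-antitoneʳ Y δA′⊑δA)
    size : cnt A ≡ suc (cnt A′)
    size = cnt-∖⁅⁆ A x Ax
    across : cnt (Y ∩ δᶠ A) ≡ cnt (Y ∩ δᶠ A′) + k
    across = trans (cnt-⊑ (λ e p → let (a , b) = ∧-elim p in ∧-intro a (δA′⊑δA e b)))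
                   (cong (cnt (Y ∩ δᶠ A′) +_) (cnt-cong (∩-∖-∩ Y (δᶠ A) (δᶠ A′))))
    rearrange₁ : ∀ a k b → (a + k) + suc b + 1 ≡ (a + b + 1) + (k + 1)
    rearrange₁ = solve 3 (λ a k b → (a :+ k) :+ (con 1 :+ b) :+ con 1 := (a :+ b :+ con 1) :+ (k :+ con 1)) refl
    rearrange₂ : ∀ d c s k → (d + c + s) + (k + 1) ≡ (d + k) + c + suc s
    rearrange₂ = solve 4 (λ d c s k → (d :+ c :+ s) :+ (k :+ con 1) := (d :+ k) :+ c :+ (con 1 :+ s)) refl

  endsAt : (Edge → Vertex) → Vertex → EdgeSet
  endsAt end v e = ⌊ end e ≟ v ⌋

  deg : EdgeSet → Vertex → ℕ
  deg Y v = cnt (Y ∩ endsAt end₁ v) + cnt (Y ∩ endsAt end₂ v)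

  degree-split : ∀ Y v → degree G v ≡ deg Y v + deg (∁ᶠ Y) v
  degree-split Y v = trans (cong₂ _+_ (split end₁) (split end₂))
                           (interchange +-commutativeSemigroup (cnt (Y ∩ endsAt end₁ v)) _ (cnt (Y ∩ endsAt end₂ v)) _)
    where
    split : ∀ end → cnt (endsAt end v) ≡ cnt (Y ∩ endsAt end v) + cnt (∁ᶠ Y ∩ endsAt end v)
    split end = trans (cnt-split (endsAt end v) Y)
                      (cong₂ _+_ (cnt-cong (λ e → ∧-comm _ (Y e))) (cnt-cong (λ e → ∧-comm _ (not (Y e)))))

  deg-mono : ∀ {Y Y′} → Y ⊑ Y′ → ∀ v → deg Y v ≤ deg Y′ v
  deg-mono h v = +-mono-≤ (cnt-mono (∩-monoˡ h _)) (cnt-mono (∩-monoˡ h _))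

  deg-mono-< : ∀ {Y Y′} → Y ⊑ Y′ → ∀ e v → Y′ e ≡ true → Y e ≡ false → Incident e v → deg Y v < deg Y′ v
  deg-mono-< h e v Y′e e∉Y (inj₁ refl) =
    +-mono-≤ (cnt-mono-< (∩-monoˡ h _) e (∧-intro Y′e (≟-refl _)) (cong (_∧ _) e∉Y)) (cnt-mono (∩-monoˡ h _))
  deg-mono-< {Y} {Y′} h e v Y′e e∉Y (inj₂ refl) = subst (_≤ deg Y′ v) (+-suc _ _)
    (+-mono-≤ (cnt-mono (∩-monoˡ h _)) (cnt-mono-< (∩-monoˡ h _) e (∧-intro Y′e (≟-refl _)) (cong (_∧ _) e∉Y)))

  deg-pos : ∀ Y e v → Y e ≡ true → Incident e v → 1 ≤ deg Y v
  deg-pos Y e v Ye ev = ≤-trans (s≤s z≤n) (deg-mono-< {λ _ → false} {Y} (λ _ ()) e v Ye refl ev)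

  deg-two : ∀ Y e g v → e ≢ g → Y e ≡ true → Y g ≡ true → Incident e v → Incident g v → 2 ≤ deg Y v
  deg-two Y e g v e≢g Ye Yg (inj₁ p) (inj₁ q) =
    ≤-trans (cnt-≥2 e g e≢g (∧-intro Ye (≟-≡ p)) (∧-intro Yg (≟-≡ q))) (m≤m+n _ _)
  deg-two Y e g v e≢g Ye Yg (inj₂ p) (inj₂ q) =
    ≤-trans (cnt-≥2 e g e≢g (∧-intro Ye (≟-≡ p)) (∧-intro Yg (≟-≡ q))) (m≤n+m _ _)
  deg-two Y e g v e≢g Ye Yg (inj₁ p) (inj₂ q) =
    +-mono-≤ (cnt-pos e (∧-intro Ye (≟-≡ p))) (cnt-pos g (∧-intro Yg (≟-≡ q)))
  deg-two Y e g v e≢g Ye Yg (inj₂ p) (inj₁ q) =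
    +-mono-≤ (cnt-pos g (∧-intro Yg (≟-≡ q))) (cnt-pos e (∧-intro Ye (≟-≡ p)))

  deg-pos⇒incident : ∀ Y v → 1 ≤ deg Y v → ∃ λ e → Y e ≡ true × Incident e v
  deg-pos⇒incident Y v p with cnt (Y ∩ endsAt end₁ v) in eq
  ... | zero  = let (e , q) = cnt-pos⇒∃ (Y ∩ endsAt end₂ v) p ; (Ye , ev) = ∧-elim q in e , Ye , inj₂ (≟-sound ev)
  ... | suc _ = let (e , q) = cnt-pos⇒∃ (Y ∩ endsAt end₁ v) (subst (1 ≤_) (sym eq) (s≤s z≤n)) ; (Ye , ev) = ∧-elim q in
                e , Ye , inj₁ (≟-sound ev)

  traverses-incident₁ : ∀ {e w v} → Traverses e w v → Incident e w
  traverses-incident₁ (inj₁ (p , _)) = inj₂ p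
  traverses-incident₁ (inj₂ (p , _)) = inj₁ p

  traverses-incident₂ : ∀ {e w v} → Traverses e w v → Incident e v
  traverses-incident₂ (inj₁ (_ , q)) = inj₁ q
  traverses-incident₂ (inj₂ (_ , q)) = inj₂ q

  from-ends : ∀ {e w v} (S : Vertex → Set) → Traverses e w v → S (end₁ e) → S (end₂ e) → S w × S v
  from-ends S (inj₁ (refl , refl)) s₁ s₂ = s₂ , s₁
  from-ends S (inj₂ (refl , refl)) s₁ s₂ = s₁ , s₂

  to-ends : ∀ {e w v} (S : Vertex → Set) → Traverses e w v → S w → S v → S (end₁ e) × S (end₂ e)
  to-ends S (inj₁ (refl , refl)) sw sv = sv , sw
  to-ends S (inj₂ (refl , refl)) sw sv = sw , sv

  -- An ear x –f– w₁ – ⋯ – t – y attached to the vertex set Uo spanned by Yo: P collects the new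
  -- vertices w₁, …, t, and it is found by walking down the distance layers `near` from Uo in G − f.
  module Ears (Yo : EdgeSet) (Uo : VertexSet) (f : Edge) (x w₁ : Vertex) (f-x-w₁ : Traverses f x w₁)
              (x∈Uo : Uo x ≡ true) (w₁∉Uo : Uo w₁ ≡ false)
              (Yo-inside : ∀ e → Yo e ≡ true → Uo (end₁ e) ≡ true × Uo (end₂ e) ≡ true) where

    f∉Yo : Yo f ≡ false
    f∉Yo = ¬-not (λ f∉Yo → let (Uo₁ , Uo₂) = Yo-inside f f∉Yo in
                 true≢false (proj₂ (from-ends (λ v → Uo v ≡ true) f-x-w₁ Uo₁ Uo₂)) w₁∉Uo)

    OnPath : EdgeSet → Edge → Vertex → Set
    OnPath Y e t = ∃ λ a → ∃ λ b → Traverses e a b × Linked (Y ∖ ⁅ e ⁆) a x × Linked (Y ∖ ⁅ e ⁆) b t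

    record PartialEar : Set where
      field
        Y        : EdgeSet
        P        : VertexSet
        t        : Vertex
        t∈P      : P t ≡ true
        w₁∈P     : P w₁ ≡ true
        Yo⊑Y     : Yo ⊑ Y
        f∈Y      : Y f ≡ true
        Y-new    : ∀ e → Y e ≡ true → Yo e ≡ false → e ≡ f ⊎ (P (end₁ e) ≡ true × P (end₂ e) ≡ true)
        P-linked : ∀ v → P v ≡ true → Linked Y v x
        on-path  : ∀ e → Y e ≡ true → Yo e ≡ false → OnPath Y e t
        P-deg    : ∀ v → P v ≡ true → v ≢ t → 2 ≤ deg Y v
        t-deg    : 1 ≤ deg Y t
        size     : cnt Y ≡ cnt Yo + cnt P

    begin-ear : PartialEar
    begin-ear = record
      { Y = Yo ∪ ⁅ f ⁆ ; P = ⁅ w₁ ⁆ ; t = w₁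
      ; t∈P = ≟-refl w₁ ; w₁∈P = ≟-refl w₁
      ; Yo⊑Y = ⊑-∪ Yo ⁅ f ⁆
      ; f∈Y = ∪⁅⁆-new Yo f
      ; Y-new = λ e p e∉Yo → inj₁ (only-f p e∉Yo)
      ; P-linked = λ v p → subst (λ u → Linked (Yo ∪ ⁅ f ⁆) u x) (sym (≟-sound p))
                                 (linked-edge f (∪⁅⁆-new Yo f) (traverses-sym f-x-w₁))
      ; on-path = λ e p e∉Yo → subst (λ e → OnPath (Yo ∪ ⁅ f ⁆) e w₁) (sym (only-f p e∉Yo))
                                 (x , w₁ , f-x-w₁ , linked-refl x , linked-refl w₁)
      ; P-deg = λ v p v≢w₁ → ⊥-elim (v≢w₁ (≟-sound p))
      ; t-deg = deg-pos (Yo ∪ ⁅ f ⁆) f w₁ (∪⁅⁆-new Yo f) (traverses-incident₂ f-x-w₁)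
      ; size = trans (cnt-∪⁅⁆ Yo f f∉Yo) (trans (+-comm 1 (cnt Yo)) (cong (cnt Yo +_) (sym (cnt-⁅⁆ w₁))))
      }
      where
      only-f : ∀ {e} → (Yo ∪ ⁅ f ⁆) e ≡ true → Yo e ≡ false → e ≡ f
      only-f p e∉Yo with ∪⁅⁆-elim Yo f p
      ... | inj₁ q   = ⊥-elim (true≢false q e∉Yo)
      ... | inj₂ e≡f = e≡f

    grow : (E : PartialEar) (e : Edge) (t′ : Vertex) → Traverses e t′ (PartialEar.t E) →
           PartialEar.Y E e ≡ false → PartialEar.P E t′ ≡ false → PartialEar
    grow E e t′ e-t′-t e∉Y t′∉P = record
      { Y = Y₁ ; P = P₁ ; t = t′
      ; t∈P = ∪⁅⁆-new P t′
      ; w₁∈P = ⊑-∪ P ⁅ t′ ⁆ w₁ w₁∈P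
      ; Yo⊑Y = λ e′ p → Y⊑Y₁ e′ (Yo⊑Y e′ p)
      ; f∈Y = Y⊑Y₁ f f∈Y
      ; Y-new = Y-new₁
      ; P-linked = P-linked₁
      ; on-path = on-path₁
      ; P-deg = P-deg₁
      ; t-deg = deg-pos Y₁ e t′ (∪⁅⁆-new Y e) (traverses-incident₁ e-t′-t)
      ; size = trans (cnt-∪⁅⁆ Y e e∉Y) (trans (cong suc size)
                 (trans (sym (+-suc (cnt Yo) (cnt P))) (cong (cnt Yo +_) (sym (cnt-∪⁅⁆ P t′ t′∉P)))))
      }
      where
      open PartialEar E
      Y₁ : EdgeSet
      Y₁ = Y ∪ ⁅ e ⁆
      P₁ : VertexSet
      P₁ = P ∪ ⁅ t′ ⁆
      Y⊑Y₁ : Y ⊑ Y₁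
      Y⊑Y₁ = ⊑-∪ Y ⁅ e ⁆
      Y-new₁ : ∀ e′ → Y₁ e′ ≡ true → Yo e′ ≡ false → e′ ≡ f ⊎ (P₁ (end₁ e′) ≡ true × P₁ (end₂ e′) ≡ true)
      Y-new₁ e′ p e′∉Yo with ∪⁅⁆-elim Y e p
      ... | inj₂ refl = inj₂ (to-ends (λ v → P₁ v ≡ true) e-t′-t (∪⁅⁆-new P t′) (⊑-∪ P ⁅ t′ ⁆ t t∈P))
      ... | inj₁ e′∈Y with Y-new e′ e′∈Y e′∉Yo
      ...   | inj₁ e′≡f = inj₁ e′≡f
      ...   | inj₂ (P₁e , P₂e) = inj₂ (⊑-∪ P ⁅ t′ ⁆ _ P₁e , ⊑-∪ P ⁅ t′ ⁆ _ P₂e)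
      P-linked₁ : ∀ v → P₁ v ≡ true → Linked Y₁ v x
      P-linked₁ v p with ∨-elim {P v} p
      ... | inj₁ Pv = linked-mono Y⊑Y₁ (P-linked v Pv)
      ... | inj₂ q rewrite ≟-sound q =
        linked-trans (linked-edge e (∪⁅⁆-new Y e) e-t′-t) (linked-mono Y⊑Y₁ (P-linked t t∈P))
      on-path₁ : ∀ e′ → Y₁ e′ ≡ true → Yo e′ ≡ false → OnPath Y₁ e′ t′
      on-path₁ e′ p e′∉Yo with ∪⁅⁆-elim Y e p
      ... | inj₂ refl = t , t′ , traverses-sym e-t′-t ,
                        linked-mono (⊑-∪⁅⁆-∖⁅⁆ Y e e∉Y) (P-linked t t∈P) , linked-refl t′
      ... | inj₁ e′∈Y =
        let (a , b , a-b , a-x , b-t) = on-path e′ e′∈Y e′∉Yo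
            lift = linked-mono (∖-monoˡ Y⊑Y₁ ⁅ e′ ⁆)
            t-t′ = linked-edge e (∖⁅⁆-other Y₁ e′ (∪⁅⁆-new Y e) (∈-∉-≢ e′∈Y e∉Y ∘ sym)) (traverses-sym e-t′-t)
        in a , b , a-b , lift a-x , linked-trans (lift b-t) t-t′
      P-deg₁ : ∀ v → P₁ v ≡ true → v ≢ t′ → 2 ≤ deg Y₁ v
      P-deg₁ v p v≢t′ with ∨-elim {P v} p
      ... | inj₂ q = ⊥-elim (v≢t′ (≟-sound q))
      ... | inj₁ Pv with v ≟ t
      ...   | yes refl = ≤-trans (s≤s t-deg) (deg-mono-< Y⊑Y₁ e v (∪⁅⁆-new Y e) e∉Y (traverses-incident₂ e-t′-t))
      ...   | no v≢t   = ≤-trans (P-deg v Pv v≢t) (deg-mono Y⊑Y₁ v)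

    G-f : EdgeSet
    G-f = ∁ᶠ ⁅ f ⁆

    near : ℕ → VertexSet
    near j z = anyF (λ u → Uo u ∧ walk G-f j u z)

    near-intro : ∀ j {z} u → Uo u ≡ true → walk G-f j u z ≡ true → near j z ≡ true
    near-intro j {z} u Uu r = anyF-intro {f = λ u → Uo u ∧ walk G-f j u z} u (∧-intro Uu r)

    near-elim : ∀ j {z} → near j z ≡ true → ∃ λ u → Uo u ≡ true × walk G-f j u z ≡ true
    near-elim j p = let (u , q) = anyF-elim p in u , ∧-elim q

    near-suc : ∀ j {z} → near j z ≡ true → near (suc j) z ≡ true
    near-suc j p = let (u , Uu , r) = near-elim j p in near-intro (suc j) u Uu (walk-weaken j r)

    Uo⇒near : ∀ j {z} → Uo z ≡ true → near j z ≡ true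
    Uo⇒near zero    {z} Uz = near-intro 0 z Uz (≟-refl z)
    Uo⇒near (suc j)     Uz = near-suc j (Uo⇒near j Uz)

    near-zero⇒Uo : ∀ {z} → near 0 z ≡ true → Uo z ≡ true
    near-zero⇒Uo p = let (u , Uu , r) = near-elim 0 p in subst (λ v → Uo v ≡ true) (≟-sound r) Uu

    descend : ∀ j {t} → near (suc j) t ≡ true → near j t ≡ false →
              ∃ λ e → ∃ λ t′ → G-f e ≡ true × Traverses e t′ t × near j t′ ≡ true
    descend j p q with near-elim (suc j) p
    ... | u , Uu , r with walk-suc-elim j r
    ...   | inj₁ r′ = ⊥-elim (true≢false (near-intro j u Uu r′) q)
    ...   | inj₂ (e , t′ , G-f-e , e-t′-t , r′) = e , t′ , G-f-e , e-t′-t , near-intro j u Uu r′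

    record Growing (j : ℕ) : Set where
      field
        partial : PartialEar
        t-near  : near (suc j) (PartialEar.t partial) ≡ true
        P-far   : ∀ v → PartialEar.P partial v ≡ true → near j v ≡ false

    module _ {j} (S : Growing j) where
      open Growing S
      open PartialEar partial

      P-outside : ∀ v → P v ≡ true → Uo v ≡ false
      P-outside v Pv = ¬-not (λ Uv → true≢false (Uo⇒near j Uv) (P-far v Pv))

      toward-Uo : ∃ λ e → ∃ λ t′ → G-f e ≡ true × Traverses e t′ t × near j t′ ≡ true
      toward-Uo = descend j t-near (P-far t t∈P)

      new-at-tip : ∀ {e w} → G-f e ≡ true → Traverses e w t → P w ≡ false → Y e ≡ false
      new-at-tip {e} {w} G-f-e e-w-t Pw = ¬-not absurd
        where
        absurd : Y e ≡ true → ⊥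
        absurd Ye with bool-cases (Yo e)
        ... | inj₁ e∈Yo = let (U₁ , U₂) = Yo-inside e e∈Yo in
                          true≢false (proj₂ (from-ends (λ v → Uo v ≡ true) e-w-t U₁ U₂)) (P-outside t t∈P)
        ... | inj₂ e∉Yo with Y-new e Ye e∉Yo
        ...   | inj₁ refl = true≢false G-f-e (cong not (≟-refl f))
        ...   | inj₂ (P₁ , P₂) = true≢false (proj₁ (from-ends (λ v → P v ≡ true) e-w-t P₁ P₂)) Pw

    start : ∀ j → near (suc j) w₁ ≡ true → near j w₁ ≡ false → Growing j
    start j p q = record
      { partial = begin-ear
      ; t-near = p
      ; P-far = λ v Pv → subst (λ u → near j u ≡ false) (sym (≟-sound Pv)) q
      }

    extend : ∀ j → Growing (suc j) → Growing j
    extend j S with toward-Uo S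
    ... | e , t′ , G-f-e , e-t′-t , near-t′ = record
      { partial = grow partial e t′ e-t′-t (new-at-tip S G-f-e e-t′-t t′∉P) t′∉P
      ; t-near = near-t′
      ; P-far = P-far₁
      }
      where
      open Growing S
      open PartialEar partial
      t′∉P : P t′ ≡ false
      t′∉P = ¬-not (λ Pt′ → true≢false near-t′ (P-far t′ Pt′))
      P-far₁ : ∀ v → (P ∪ ⁅ t′ ⁆) v ≡ true → near j v ≡ false
      P-far₁ v p with ∪⁅⁆-elim P t′ p
      ... | inj₁ Pv   = ¬-not (λ q → true≢false (near-suc j q) (P-far v Pv))
      ... | inj₂ refl = ¬-not (λ q → let (u , Uu , r) = near-elim j q in
                          true≢false (near-intro (suc j) u Uu (walk-step j e G-f-e e-t′-t r)) (P-far t t∈P))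

    descend-all : ∀ j → Growing j → Growing 0
    descend-all zero    S = S
    descend-all (suc j) S = descend-all j (extend j S)

    first-layer : ∀ k → near k w₁ ≡ true → ∃ λ j → near (suc j) w₁ ≡ true × near j w₁ ≡ false
    first-layer zero    p = ⊥-elim (true≢false (near-zero⇒Uo p) w₁∉Uo)
    first-layer (suc k) p with bool-cases (near k w₁)
    ... | inj₁ q = first-layer k q
    ... | inj₂ q = k , p , q

    record Ear : Set where
      field
        partial    : PartialEar
        y          : Vertex
        e꜀         : Edge
        closing    : Traverses e꜀ y (PartialEar.t partial)
        y∈Uo       : Uo y ≡ true
        e꜀∉Y       : PartialEar.Y partial e꜀ ≡ false
        P-disjoint : ∀ v → PartialEar.P partial v ≡ true → Uo v ≡ false

    close : Growing 0 → Ear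
    close S with toward-Uo S
    ... | e , y , G-f-e , e-y-t , near-y = record
      { partial = partial
      ; y = y ; e꜀ = e ; closing = e-y-t
      ; y∈Uo = y∈Uo
      ; e꜀∉Y = new-at-tip S G-f-e e-y-t (¬-not (λ Py → true≢false y∈Uo (P-outside S y Py)))
      ; P-disjoint = P-outside S
      }
      where
      open Growing S
      y∈Uo : Uo y ≡ true
      y∈Uo = near-zero⇒Uo near-y

    ear : Linked G-f x w₁ → Ear
    ear r = let (j , p , q) = first-layer (n G) (near-intro (n G) x x∈Uo (linked⇒walk G-f x r))
            in close (descend-all j (start j p q))

    module Closed (E : Ear) (Uo-connected : ∀ u v → Uo u ≡ true → Uo v ≡ true → Linked Yo u v) where
      open Ear E
      open PartialEar partial

      Y⁺ : EdgeSet
      Y⁺ = Y ∪ ⁅ e꜀ ⁆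

      U⁺ : VertexSet
      U⁺ = Uo ∪ P

      Y⊑Y⁺ : Y ⊑ Y⁺
      Y⊑Y⁺ = ⊑-∪ Y ⁅ e꜀ ⁆

      Yo⊑Y⁺ : Yo ⊑ Y⁺
      Yo⊑Y⁺ e p = Y⊑Y⁺ e (Yo⊑Y e p)

      y-t : Linked Y y t
      y-t = linked-trans (linked-mono Yo⊑Y (Uo-connected y x y∈Uo x∈Uo)) (linked-sym (P-linked t t∈P))

      inside⁺ : ∀ e → Y⁺ e ≡ true → U⁺ (end₁ e) ≡ true × U⁺ (end₂ e) ≡ true
      inside⁺ e p with ∪⁅⁆-elim Y e꜀ p
      ... | inj₂ refl = to-ends (λ v → U⁺ v ≡ true) closing (∨-introˡ _ y∈Uo) (∨-introʳ (Uo t) t∈P)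
      ... | inj₁ Ye with bool-cases (Yo e)
      ...   | inj₁ e∈Yo = let (U₁ , U₂) = Yo-inside e e∈Yo in ∨-introˡ _ U₁ , ∨-introˡ _ U₂
      ...   | inj₂ e∉Yo with Y-new e Ye e∉Yo
      ...     | inj₁ refl = to-ends (λ v → U⁺ v ≡ true) f-x-w₁ (∨-introˡ _ x∈Uo) (∨-introʳ (Uo w₁) w₁∈P)
      ...     | inj₂ (P₁ , P₂) = ∨-introʳ (Uo (end₁ e)) P₁ , ∨-introʳ (Uo (end₂ e)) P₂

      linked-x⁺ : ∀ v → U⁺ v ≡ true → Linked Y⁺ v x
      linked-x⁺ v p with ∨-elim {Uo v} p
      ... | inj₁ Uv = linked-mono Yo⊑Y⁺ (Uo-connected v x Uv x∈Uo)
      ... | inj₂ Pv = linked-mono Y⊑Y⁺ (P-linked v Pv)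

      -- Each new edge lies on the cycle formed by the ear and a Yo-path from y back to x.
      new-bridgeless⁺ : ∀ e → Y⁺ e ≡ true → Yo e ≡ false → Linked (Y⁺ ∖ ⁅ e ⁆) (end₁ e) (end₂ e)
      new-bridgeless⁺ e p e∉Yo with ∪⁅⁆-elim Y e꜀ p
      ... | inj₂ refl = linked-ends closing (linked-mono (⊑-∪⁅⁆-∖⁅⁆ Y e꜀ e꜀∉Y) y-t)
      ... | inj₁ Ye =
        let (a , b , a-b , a-x , b-t) = on-path e Ye e∉Yo
            lift = linked-mono (∖-monoˡ Y⊑Y⁺ ⁅ e ⁆)
            x-y = linked-mono (λ e′ e′∈Yo → ∖⁅⁆-other Y⁺ e (Yo⊑Y⁺ e′ e′∈Yo) (∈-∉-≢ e′∈Yo e∉Yo))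
                              (Uo-connected x y x∈Uo y∈Uo)
            y-t⁺ = linked-edge e꜀ (∖⁅⁆-other Y⁺ e (∪⁅⁆-new Y e꜀) (∈-∉-≢ Ye e꜀∉Y ∘ sym)) closing
        in linked-ends a-b (linked-trans (lift a-x) (linked-trans x-y (linked-trans y-t⁺ (linked-sym (lift b-t)))))

      P-deg⁺ : ∀ v → P v ≡ true → 2 ≤ deg Y⁺ v
      P-deg⁺ v Pv with v ≟ t
      ... | yes refl = ≤-trans (s≤s t-deg) (deg-mono-< Y⊑Y⁺ e꜀ v (∪⁅⁆-new Y e꜀) e꜀∉Y (traverses-incident₂ closing))
      ... | no v≢t   = ≤-trans (P-deg v Pv v≢t) (deg-mono Y⊑Y⁺ v)

      size⁺ : cnt Y⁺ ≡ suc (cnt Yo + cnt P)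
      size⁺ = trans (cnt-∪⁅⁆ Y e꜀ e꜀∉Y) (cong suc size)

      cnt-U⁺ : cnt U⁺ ≡ cnt Uo + cnt P
      cnt-U⁺ = cnt-∪ Uo P (λ v Uv → ¬-not (λ Pv → true≢false Uv (P-disjoint v Pv)))

      P-closed : ∀ e w v → Y e ≡ true → e ≢ f → Traverses e w v → P w ≡ true → P v ≡ true
      P-closed e w v Ye e≢f e-w-v Pw with bool-cases (Yo e)
      ... | inj₁ e∈Yo = let (U₁ , U₂) = Yo-inside e e∈Yo in
                        ⊥-elim (true≢false (proj₁ (from-ends (λ v → Uo v ≡ true) e-w-v U₁ U₂)) (P-disjoint w Pw))
      ... | inj₂ e∉Yo with Y-new e Ye e∉Yo
      ...   | inj₁ e≡f = ⊥-elim (e≢f e≡f)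
      ...   | inj₂ (P₁ , P₂) = proj₂ (from-ends (λ v → P v ≡ true) e-w-v P₁ P₂)

      -- When A contains x, the edge f lies in δ(A), so within Y ∖ δ(A) the ear is cut off from Uo;
      -- the closing edge, which avoids δ(A), joins two of its components.
      loose⁺ : ∀ A s → A ⊑ Uo → A x ≡ true → A y ≡ false → Loose Yo A (suc s) → Loose Y⁺ A s
      loose⁺ A s A⊑Uo Ax Ay loose =
        loose-∪⁅⁆-chord-¬δ Y A s e꜀ e꜀∉δ (linked-ends closing y-t) cut (loose-mono A (suc s) Yo⊑Y loose)
        where
        At : A t ≡ false
        At = ¬-not (λ At → true≢false (A⊑Uo t At) (P-disjoint t t∈P))
        e꜀∉δ : δᶠ A e꜀ ≡ false
        e꜀∉δ = let (A₁ , A₂) = to-ends (λ v → A v ≡ false) closing Ay At in cong₂ _∨_ A₁ A₂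
        cut : ¬ Linked (Y ∖ δᶠ A) (end₁ e꜀) (end₂ e꜀)
        cut r = true≢false (linked-closed P closed (ends-linked (traverses-sym closing) r) t∈P)
                           (¬-not (λ Py → true≢false y∈Uo (P-disjoint y Py)))
          where
          closed : ∀ e w v → (Y ∖ δᶠ A) e ≡ true → Traverses e w v → P w ≡ true → P v ≡ true
          closed e w v p = let (Ye , e∉δ) = ∧-elim p in
            P-closed e w v Ye (∈-∉-≢ {Z = ∁ᶠ (δᶠ A)} e∉δ (cong not (δᶠ-incident A f x Ax (traverses-incident₁ f-x-w₁))))

  module Construction (trivalent : Trivalent G) (two-edge-connected : TwoEdgeConnected G) where

    connected : ∀ u v → Linked (λ _ → true) u v
    connected u v = reach⇒linked ⊤ (λ e → lookup-replicate e true) u v (proj₁ two-edge-connected u v)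

    G-f-connected : ∀ f u v → Linked (∁ᶠ ⁅ f ⁆) u v
    G-f-connected f u v = reach⇒linked (⊤ - f) (lookup-⊤-x f) u v (proj₂ two-edge-connected f u v)

    closed-everywhere : ∀ (S : VertexSet) → (∀ e w v → Traverses e w v → S w ≡ true → S v ≡ true) →
                        (∃ λ u → S u ≡ true) → ∀ v → S v ≡ true
    closed-everywhere S closed (u , Su) v = linked-closed S (λ e w v _ → closed e w v) (connected u v) Su

    two-and-two-impossible : ∀ Y v → 2 ≤ deg Y v → 2 ≤ deg (∁ᶠ Y) v → ⊥
    two-and-two-impossible Y v p q =
      <-irrefl refl (≤-trans (+-mono-≤ p q) (≤-reflexive (trans (sym (degree-split Y v)) (trivalent v))))

    unique-edge-outside : ∀ Y v → 2 ≤ deg Y v → ∀ {f g} → Y f ≡ false → Y g ≡ false →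
                          Incident f v → Incident g v → g ≡ f
    unique-edge-outside Y v two {f} {g} Yf Yg fv gv with g ≟ f
    ... | yes g≡f = g≡f
    ... | no g≢f  = ⊥-elim (two-and-two-impossible Y v two
                      (deg-two (∁ᶠ Y) f g v (g≢f ∘ sym) (cong not Yf) (cong not Yg) fv gv))

    -- If every edge at v were a loop, degree v would be even.
    proper-edge-at : ∀ v → ∃ λ f → ∃ λ w → Traverses f v w × w ≢ v
    proper-edge-at v with bool-cases (anyF (λ e → ⌊ end₁ e ≟ v ⌋ xor ⌊ end₂ e ≟ v ⌋))
    ... | inj₁ some = let (f , p) = anyF-elim some in orient f (⌊ end₁ f ≟ v ⌋) refl p
      where
      orient : ∀ f b → ⌊ end₁ f ≟ v ⌋ ≡ b → b xor ⌊ end₂ f ≟ v ⌋ ≡ true → ∃ λ f → ∃ λ w → Traverses f v w × w ≢ v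
      orient f true  p q = f , end₂ f , inj₂ (≟-sound p , refl) , λ w≡v → true≢false (≟-≡ w≡v) (not-injective q)
      orient f false p q = f , end₁ f , inj₁ (≟-sound q , refl) , λ w≡v → true≢false (≟-≡ w≡v) p
    ... | inj₂ none = ⊥-elim (odd (cnt (λ e → ⌊ end₁ e ≟ v ⌋))
                        (trans (cong (cnt (λ e → ⌊ end₁ e ≟ v ⌋) +_) (cnt-cong same)) (trivalent v)))
      where
      same : ∀ e → ⌊ end₁ e ≟ v ⌋ ≡ ⌊ end₂ e ≟ v ⌋
      same e = xor-false (¬-not (λ p → true≢false (anyF-intro {f = λ e → ⌊ end₁ e ≟ v ⌋ xor ⌊ end₂ e ≟ v ⌋} e p) none))
        where
        xor-false : ∀ {a b} → a xor b ≡ false → a ≡ b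
        xor-false {true}  {true}  _ = refl
        xor-false {false} {false} _ = refl
      odd : ∀ c → c + c ≢ 3
      odd zero ()
      odd (suc zero) ()
      odd (suc (suc c)) p with trans (sym (cong (suc ∘ suc) (trans (+-suc c (suc c)) (cong suc (+-suc c c))))) p
      ... | ()

    -- A partial ear decomposition: the bridgeless subgraph (U, Y) together with the independent set I
    -- built so far, one vertex for each ear after the first.
    record State : Set where
      field
        Y            : EdgeSet
        U I          : VertexSet
        inside       : ∀ e → Y e ≡ true → U (end₁ e) ≡ true × U (end₂ e) ≡ true
        U-connected  : ∀ u v → U u ≡ true → U v ≡ true → Linked Y u v
        bridgeless   : ∀ e → Y e ≡ true → Linked (Y ∖ ⁅ e ⁆) (end₁ e) (end₂ e)
        U-deg        : ∀ v → U v ≡ true → 2 ≤ deg Y v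
        I-saturated  : ∀ v → I v ≡ true → U v ≡ true × (∀ e → Incident e v → Y e ≡ true)
        size         : cnt Y ≡ cnt U + cnt I
        loose        : ∀ A → A ⊑ I → (∃ λ v → A v ≡ true) → Loose Y A 0
        U-nonempty   : ∃ λ v → U v ≡ true

    module Extension (S : State) (f : Edge) (x w : Vertex)
                     (f∉Y : State.Y S f ≡ false) (f-x-w : Traverses f x w) (x∈U : State.U S x ≡ true) where
      open State S

      I⁺ : VertexSet
      I⁺ = I ∪ ⁅ x ⁆

      only-f : ∀ g → Y g ≡ false → Incident g x → g ≡ f
      only-f g Yg gx = unique-edge-outside Y x (U-deg x x∈U) f∉Y Yg (traverses-incident₁ f-x-w) gx

      x∉I : I x ≡ false
      x∉I = ¬-not (λ Ix → true≢false (proj₂ (I-saturated x Ix) f (traverses-incident₁ f-x-w)) f∉Y)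

      cnt-I⁺ : cnt I⁺ ≡ suc (cnt I)
      cnt-I⁺ = cnt-∪⁅⁆ I x x∉I

      ⊑I : ∀ {A} → A ⊑ I⁺ → A x ≡ false → A ⊑ I
      ⊑I A⊑I⁺ Ax v Av with ∪⁅⁆-elim I x (A⊑I⁺ v Av)
      ... | inj₁ Iv   = Iv
      ... | inj₂ refl = ⊥-elim (true≢false Av Ax)

      I⁺-saturated : ∀ {U′ Y′} → U ⊑ U′ → Y ⊑ Y′ → Y′ f ≡ true →
                     ∀ v → I⁺ v ≡ true → U′ v ≡ true × (∀ e → Incident e v → Y′ e ≡ true)
      I⁺-saturated {U′} {Y′} U⊑U′ Y⊑Y′ f∈Y′ v p with ∪⁅⁆-elim I x p
      ... | inj₁ Iv = let (Uv , all-in) = I-saturated v Iv in U⊑U′ v Uv , λ e ev → Y⊑Y′ e (all-in e ev)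
      ... | inj₂ refl = U⊑U′ x x∈U , at-x
        where
        at-x : ∀ e → Incident e x → Y′ e ≡ true
        at-x e ex with bool-cases (Y e)
        ... | inj₁ Ye = Y⊑Y′ e Ye
        ... | inj₂ Ye rewrite only-f e Ye ex = f∈Y′

      non-bridge-at-x : NonBridgeAt Y x
      non-bridge-at-x = let (e , Ye , ex) = deg-pos⇒incident Y x (≤-trans (s≤s z≤n) (U-deg x x∈U)) in
                        e , Ye , ex , bridgeless e Ye

      loose-x : ∀ A → A ⊑ I⁺ → A x ≡ true → Loose Y A 1
      loose-x A A⊑I⁺ Ax with bool-cases (anyF (A ∖ ⁅ x ⁆))
      ... | inj₁ some = loose-add-vertex Y A 0 x Ax
                          (loose (A ∖ ⁅ x ⁆) (⊑I (λ v p → A⊑I⁺ v (proj₁ (∧-elim p))) (∖⁅⁆-removed A x)) (anyF-elim some))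
      ... | inj₂ none = loose-⁅⁆ Y A x Ax single non-bridge-at-x
        where
        single : cnt A ≡ 1
        single = trans (cnt-∖⁅⁆ A x Ax)
                       (cong suc (cnt-false (λ v → ¬-not (λ p → true≢false (anyF-intro {f = A ∖ ⁅ x ⁆} v p) none))))

      I⁺⊑U : I⁺ ⊑ U
      I⁺⊑U v p with ∪⁅⁆-elim I x p
      ... | inj₁ Iv   = proj₁ (I-saturated v Iv)
      ... | inj₂ refl = x∈U

      I⁺-avoids : ∀ g v → Y g ≡ false → g ≢ f → Incident g v → I⁺ v ≡ false
      I⁺-avoids g v Yg g≢f gv = ¬-not absurd
        where
        absurd : I⁺ v ≡ true → ⊥
        absurd p with ∪⁅⁆-elim I x p
        ... | inj₁ Iv   = true≢false (proj₂ (I-saturated v Iv) g gv) Yg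
        ... | inj₂ refl = g≢f (only-f g Yg gv)

      loose-keep : ∀ {Y′} → Y ⊑ Y′ → ∀ A → A ⊑ I⁺ → A x ≡ false → (∃ λ v → A v ≡ true) → Loose Y′ A 0
      loose-keep Y⊑Y′ A A⊑I⁺ Ax nonempty = loose-mono A 0 Y⊑Y′ (loose A (⊑I A⊑I⁺ Ax) nonempty)

      module _ (w∈U : U w ≡ true) where

        private
          Y⊑Y⁺ : Y ⊑ Y ∪ ⁅ f ⁆
          Y⊑Y⁺ = ⊑-∪ Y ⁅ f ⁆

          f-linked : Linked Y (end₁ f) (end₂ f)
          f-linked = linked-ends f-x-w (U-connected x w x∈U w∈U)

        chord-inside : ∀ e → (Y ∪ ⁅ f ⁆) e ≡ true → U (end₁ e) ≡ true × U (end₂ e) ≡ true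
        chord-inside e p with ∪⁅⁆-elim Y f p
        ... | inj₁ Ye   = inside e Ye
        ... | inj₂ refl = to-ends (λ v → U v ≡ true) f-x-w x∈U w∈U

        chord-bridgeless : ∀ e → (Y ∪ ⁅ f ⁆) e ≡ true → Linked ((Y ∪ ⁅ f ⁆) ∖ ⁅ e ⁆) (end₁ e) (end₂ e)
        chord-bridgeless e p with ∪⁅⁆-elim Y f p
        ... | inj₁ Ye   = linked-mono (∖-monoˡ Y⊑Y⁺ ⁅ e ⁆) (bridgeless e Ye)
        ... | inj₂ refl = linked-mono (⊑-∪⁅⁆-∖⁅⁆ Y f f∉Y) f-linked

        chord-loose : ∀ A → A ⊑ I⁺ → (∃ λ v → A v ≡ true) → Loose (Y ∪ ⁅ f ⁆) A 0
        chord-loose A A⊑I⁺ nonempty with bool-cases (A x)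
        ... | inj₁ Ax = loose-∪⁅⁆-chord-δ Y A 0 f f∉Y (δᶠ-incident A f x Ax (traverses-incident₁ f-x-w)) f-linked
                          (loose-x A A⊑I⁺ Ax)
        ... | inj₂ Ax = loose-keep Y⊑Y⁺ A A⊑I⁺ Ax nonempty

        chord-step : State
        chord-step = record
          { Y = Y ∪ ⁅ f ⁆ ; U = U ; I = I⁺
          ; inside = chord-inside
          ; U-connected = λ u v Uu Uv → linked-mono Y⊑Y⁺ (U-connected u v Uu Uv)
          ; bridgeless = chord-bridgeless
          ; U-deg = λ v Uv → ≤-trans (U-deg v Uv) (deg-mono Y⊑Y⁺ v)
          ; I-saturated = I⁺-saturated (λ _ p → p) Y⊑Y⁺ (∪⁅⁆-new Y f)
          ; size = trans (cnt-∪⁅⁆ Y f f∉Y) (trans (cong suc size) (trans (sym (+-suc _ _)) (cong (cnt U +_) (sym cnt-I⁺))))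
          ; loose = chord-loose
          ; U-nonempty = U-nonempty
          }

        chord-step-grows : cnt Y < cnt (Y ∪ ⁅ f ⁆)
        chord-step-grows = ≤-reflexive (sym (cnt-∪⁅⁆ Y f f∉Y))

      module _ (w∉U : U w ≡ false) (E : Ears.Ear Y U f x w f-x-w x∈U w∉U inside) where
        open Ears Y U f x w f-x-w x∈U w∉U inside
        open Ear E
        open PartialEar partial using (P; f∈Y; Yo⊑Y)
        open Closed E U-connected

        ear-bridgeless : ∀ e → Y⁺ e ≡ true → Linked (Y⁺ ∖ ⁅ e ⁆) (end₁ e) (end₂ e)
        ear-bridgeless e p with bool-cases (Y e)
        ... | inj₁ Ye  = linked-mono (∖-monoˡ Yo⊑Y⁺ ⁅ e ⁆) (bridgeless e Ye)
        ... | inj₂ e∉Y = new-bridgeless⁺ e p e∉Y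

        ear-U-deg : ∀ v → U⁺ v ≡ true → 2 ≤ deg Y⁺ v
        ear-U-deg v p with ∨-elim {U v} p
        ... | inj₁ Uv = ≤-trans (U-deg v Uv) (deg-mono Yo⊑Y⁺ v)
        ... | inj₂ Pv = P-deg⁺ v Pv

        ear-size : cnt Y⁺ ≡ cnt U⁺ + cnt I⁺
        ear-size = begin
          cnt Y⁺                              ≡⟨ size⁺ ⟩
          suc (cnt Y + cnt P)                 ≡⟨ cong (λ c → suc (c + cnt P)) size ⟩
          suc (cnt U + cnt I + cnt P)         ≡⟨ rearrange (cnt U) (cnt I) (cnt P) ⟩
          (cnt U + cnt P) + suc (cnt I)       ≡⟨ sym (cong₂ _+_ cnt-U⁺ cnt-I⁺) ⟩
          cnt U⁺ + cnt I⁺                     ∎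
          where
          open ≡-Reasoning
          open +-*-Solver
          rearrange : ∀ u i p → suc (u + i + p) ≡ (u + p) + suc i
          rearrange = solve 3 (λ u i p → con 1 :+ (u :+ i :+ p) := (u :+ p) :+ (con 1 :+ i)) refl

        y∉I⁺ : I⁺ y ≡ false
        y∉I⁺ = I⁺-avoids e꜀ y (¬-not (λ p → true≢false (Yo⊑Y e꜀ p) e꜀∉Y))
                 (∈-∉-≢ {Z = PartialEar.Y partial} f∈Y e꜀∉Y ∘ sym) (traverses-incident₁ closing)

        ear-loose : ∀ A → A ⊑ I⁺ → (∃ λ v → A v ≡ true) → Loose Y⁺ A 0
        ear-loose A A⊑I⁺ nonempty with bool-cases (A x)
        ... | inj₁ Ax = loose⁺ A 0 (λ v Av → I⁺⊑U v (A⊑I⁺ v Av)) Ax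
                          (¬-not (λ Ay → true≢false (A⊑I⁺ y Ay) y∉I⁺)) (loose-x A A⊑I⁺ Ax)
        ... | inj₂ Ax = loose-keep Yo⊑Y⁺ A A⊑I⁺ Ax nonempty

        ear-step : State
        ear-step = record
          { Y = Y⁺ ; U = U⁺ ; I = I⁺
          ; inside = inside⁺
          ; U-connected = λ u v Uu Uv → linked-trans (linked-x⁺ u Uu) (linked-sym (linked-x⁺ v Uv))
          ; bridgeless = ear-bridgeless
          ; U-deg = ear-U-deg
          ; I-saturated = I⁺-saturated (⊑-∪ U P) Yo⊑Y⁺ (Y⊑Y⁺ f f∈Y)
          ; size = ear-size
          ; loose = ear-loose
          ; U-nonempty = let (v , Uv) = U-nonempty in v , ⊑-∪ U P v Uv
          }

        ear-step-grows : cnt Y < cnt Y⁺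
        ear-step-grows = subst (cnt Y <_) (sym size⁺) (s≤s (m≤m+n (cnt Y) _))

    module _ (S : State) where
      open State S

      frontier-edge : (∃ λ e → Y e ≡ false) → ∃ λ f → ∃ λ x → ∃ λ w → Y f ≡ false × Traverses f x w × U x ≡ true
      frontier-edge (e₀ , e₀∉Y) with bool-cases (anyF (λ e → not (Y e) ∧ (U (end₁ e) ∨ U (end₂ e))))
      ... | inj₁ some = let (f , p) = anyF-elim some ; (f∉Y , q) = ∧-elim p in orient f (not-injective f∉Y) (∨-elim q)
        where
        orient : ∀ f → Y f ≡ false → U (end₁ f) ≡ true ⊎ U (end₂ f) ≡ true →
                 ∃ λ f → ∃ λ x → ∃ λ w → Y f ≡ false × Traverses f x w × U x ≡ true
        orient f f∉Y (inj₁ U₁) = f , end₁ f , end₂ f , f∉Y , inj₂ (refl , refl) , U₁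
        orient f f∉Y (inj₂ U₂) = f , end₂ f , end₁ f , f∉Y , inj₁ (refl , refl) , U₂
      ... | inj₂ none = ⊥-elim (true≢false (anyF-intro e₀ (∧-intro (cong not e₀∉Y)
                                    (∨-introˡ _ (closed-everywhere U closed U-nonempty (end₁ e₀))))) none)
        where
        closed : ∀ e w v → Traverses e w v → U w ≡ true → U v ≡ true
        closed e w v e-w-v Uw with bool-cases (Y e)
        ... | inj₁ Ye = let (U₁ , U₂) = inside e Ye in proj₂ (from-ends (λ v → U v ≡ true) e-w-v U₁ U₂)
        ... | inj₂ e∉Y = ⊥-elim (true≢false (anyF-intro e (∧-intro (cong not e∉Y) (touches e-w-v Uw))) none)
          where
          touches : ∀ {e w v} → Traverses e w v → U w ≡ true → U (end₁ e) ∨ U (end₂ e) ≡ true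
          touches (inj₁ (refl , _)) Uw = ∨-introʳ _ Uw
          touches (inj₂ (refl , _)) Uw = ∨-introˡ _ Uw

    module _ (v₀ : Vertex) (f : Edge) (w : Vertex) (f-v₀-w : Traverses f v₀ w) (w≢v₀ : w ≢ v₀)
             (E : Ears.Ear (λ _ → false) ⁅ v₀ ⁆ f v₀ w f-v₀-w (≟-refl v₀) (≟-≢ w≢v₀) (λ _ ())) where
      open Ears (λ _ → false) ⁅ v₀ ⁆ f v₀ w f-v₀-w (≟-refl v₀) (≟-≢ w≢v₀) (λ _ ())
      open Ear E
      open PartialEar partial using (P; f∈Y)
      open Closed E (λ u v p q → linked-≡ (trans (≟-sound p) (sym (≟-sound q))))

      first-ear-size : cnt Y⁺ ≡ cnt U⁺ + cnt {n G} (λ _ → false)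
      first-ear-size = begin
        cnt Y⁺                                ≡⟨ size⁺ ⟩
        suc (cnt {m G} (λ _ → false) + cnt P) ≡⟨ cong (λ c → suc (c + cnt P)) (cnt-false {m G} {λ _ → false} (λ _ → refl)) ⟩
        suc (cnt P)                           ≡⟨ cong (_+ cnt P) (sym (cnt-⁅⁆ v₀)) ⟩
        cnt ⁅ v₀ ⁆ + cnt P                    ≡⟨ sym cnt-U⁺ ⟩
        cnt U⁺                                ≡⟨ sym (+-identityʳ _) ⟩
        cnt U⁺ + 0                            ≡⟨ cong (cnt U⁺ +_) (sym (cnt-false {n G} {λ _ → false} (λ _ → refl))) ⟩
        cnt U⁺ + cnt {n G} (λ _ → false)      ∎
        where open ≡-Reasoning

      first-ear-U-deg : ∀ v → U⁺ v ≡ true → 2 ≤ deg Y⁺ v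
      first-ear-U-deg v p with ∨-elim {⁅ v₀ ⁆ v} p
      ... | inj₂ Pv = P-deg⁺ v Pv
      ... | inj₁ q rewrite ≟-sound q =
        deg-two Y⁺ f e꜀ v₀ (∈-∉-≢ {Z = PartialEar.Y partial} f∈Y e꜀∉Y) (Y⊑Y⁺ f f∈Y) (∪⁅⁆-new (PartialEar.Y partial) e꜀)
                (traverses-incident₁ f-v₀-w) (subst (Incident e꜀) (≟-sound y∈Uo) (traverses-incident₁ closing))

      first-ear-state : State
      first-ear-state = record
        { Y = Y⁺ ; U = U⁺ ; I = λ _ → false
        ; inside = inside⁺
        ; U-connected = λ u v Uu Uv → linked-trans (linked-x⁺ u Uu) (linked-sym (linked-x⁺ v Uv))
        ; bridgeless = λ e p → new-bridgeless⁺ e p refl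
        ; U-deg = first-ear-U-deg
        ; I-saturated = λ _ ()
        ; size = first-ear-size
        ; loose = λ A A⊑∅ (v , Av) → ⊥-elim (true≢false (A⊑∅ v Av) refl)
        ; U-nonempty = v₀ , ∨-introˡ _ (≟-refl v₀)
        }

    initial : Vertex → State
    initial v₀ = let (f , w , f-v₀-w , w≢v₀) = proper-edge-at v₀ in
      first-ear-state v₀ f w f-v₀-w w≢v₀
        (Ears.ear (λ _ → false) ⁅ v₀ ⁆ f v₀ w f-v₀-w (≟-refl v₀) (≟-≢ w≢v₀) (λ _ ()) (G-f-connected f v₀ w))

    step : (S : State) → (∃ λ e → State.Y S e ≡ false) → Σ State λ S′ → cnt (State.Y S) < cnt (State.Y S′)
    step S missing with frontier-edge S missing
    ... | f , x , w , f∉Y , f-x-w , x∈U with bool-cases (State.U S w)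
    ...   | inj₁ w∈U = chord-step w∈U , chord-step-grows w∈U
      where open Extension S f x w f∉Y f-x-w x∈U
    ...   | inj₂ w∉U = ear-step w∉U E , ear-step-grows w∉U E
      where
      open Extension S f x w f∉Y f-x-w x∈U
      open State S
      E : Ears.Ear Y U f x w f-x-w x∈U w∉U inside
      E = Ears.ear Y U f x w f-x-w x∈U w∉U inside (G-f-connected f x w)

    complete : ∀ fuel (S : State) → m G ≤ cnt (State.Y S) + fuel → Σ State λ S → ∀ e → State.Y S e ≡ true
    complete fuel S bound with bool-cases (anyF (∁ᶠ (State.Y S)))
    ... | inj₂ none = S , λ e → not-injective (¬-not (λ p → true≢false (anyF-intro {f = ∁ᶠ (State.Y S)} e p) none))
    ... | inj₁ some with anyF-elim {f = ∁ᶠ (State.Y S)} some | fuel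
    ...   | e₀ , e₀∉Y | zero = ⊥-elim (<-irrefl refl (begin-strict
            cnt (State.Y S)          <⟨ cnt-mono-< {f = State.Y S} {λ _ → true} (λ _ _ → refl) e₀ refl (not-injective e₀∉Y) ⟩
            cnt {m G} (λ _ → true)   ≡⟨ cnt-true ⟩
            m G                      ≤⟨ bound ⟩
            cnt (State.Y S) + 0      ≡⟨ +-identityʳ _ ⟩
            cnt (State.Y S)          ∎))
      where open ≤-Reasoning
    ...   | e₀ , e₀∉Y | suc fuel with step S (e₀ , not-injective e₀∉Y)
    ...     | S′ , grows = complete fuel S′ (≤-trans bound (≤-trans (≤-reflexive (+-suc _ fuel)) (+-monoˡ-≤ fuel grows)))

    independent-set : Vertex → Σ VertexSet λ I → cnt I + n G ≡ m G ×
                      (∀ A → A ⊑ I → (∃ λ v → A v ≡ true) → Loose (λ _ → true) A 0)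
    independent-set v₀ = I , counted , λ A A⊑I nonempty → loose-cong A 0 full (loose A A⊑I nonempty)
      where
      final : Σ State λ S → ∀ e → State.Y S e ≡ true
      final = complete (m G) (initial v₀) (m≤n+m (m G) _)
      open State (proj₁ final)
      full : Y ≐ (λ _ → true)
      full = proj₂ final
      everywhere : ∀ v → U v ≡ true
      everywhere = closed-everywhere U (λ e w v e-w-v _ → let (U₁ , U₂) = inside e (full e) in
                                         proj₂ (from-ends (λ v → U v ≡ true) e-w-v U₁ U₂)) U-nonempty
      counted : cnt I + n G ≡ m G
      counted = begin
        cnt I + n G         ≡⟨ +-comm (cnt I) (n G) ⟩
        n G + cnt I         ≡⟨ cong (_+ cnt I) (sym (trans (cnt-cong everywhere) cnt-true)) ⟩
        cnt U + cnt I       ≡⟨ sym size ⟩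
        cnt Y               ≡⟨ trans (cnt-cong full) cnt-true ⟩
        m G                 ∎
        where open ≡-Reasoning

    #comp-E : Vertex → #comp (λ _ → true) ≡ 1
    #comp-E v₀ = #comp-connected v₀ (λ _ → true) connected

    graphicRank-⊤ : Vertex → graphicRank G ⊤ ≡ n G ∸ 1
    graphicRank-⊤ v₀ = cong (n G ∸_) (trans (components≡#comp ⊤)
                                         (trans (#comp-cong (λ e → lookup-replicate e true)) (#comp-E v₀)))

    bondRank≤genus : Vertex → ∀ X → bondRank G X ≤ genus G
    bondRank≤genus v₀ X = begin
      ∣ X ∣ + (n G ∸ components G (∁ X)) ∸ graphicRank G ⊤  ≡⟨ cong₂ (λ a c → a + (n G ∸ c) ∸ graphicRank G ⊤) (size-cnt X) comp≡ ⟩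
      cnt X′ + (n G ∸ #comp (∁ᶠ X′)) ∸ graphicRank G ⊤    ≤⟨ ∸-monoˡ-≤ (graphicRank G ⊤) (+-monoʳ-≤ (cnt X′) forest-bound) ⟩
      cnt X′ + cnt (∁ᶠ X′) ∸ graphicRank G ⊤              ≡⟨ cong₂ _∸_ edges≡ (graphicRank-⊤ v₀) ⟩
      m G ∸ (n G ∸ 1)                                      ≡⟨ m∸[n∸1]≡m+1∸n (m G) (n G) v₀ ⟩
      genus G                                              ∎
      where
      open ≤-Reasoning
      X′ : EdgeSet
      X′ = lookup X
      comp≡ : components G (∁ X) ≡ #comp (∁ᶠ X′)
      comp≡ = trans (components≡#comp (∁ X)) (#comp-cong (λ e → lookup-map e not X))
      forest-bound : n G ∸ #comp (∁ᶠ X′) ≤ cnt (∁ᶠ X′)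
      forest-bound = ≤-trans (∸-monoˡ-≤ (#comp (∁ᶠ X′)) (n≤#comp+cnt (∁ᶠ X′))) (≤-reflexive (m+n∸m≡n (#comp (∁ᶠ X′)) _))
      edges≡ : cnt X′ + cnt (∁ᶠ X′) ≡ m G
      edges≡ = trans (sym (cnt-split (λ _ → true) X′)) cnt-true

    loose⇒¬tight : Vertex → ∀ C → Loose (λ _ → true) (lookup C) 0 → ¬ Tight G C
    loose⇒¬tight v₀ C loose tight =
      <-irrefl refl (<-≤-trans (bond-rank-arith loose′ (cnt≤ (isRoot (∁ᶠ (δᶠ A)))) v₀) (subst₂ _≤_ bond≡ (size-cnt C) tight))
      where
      A : VertexSet
      A = lookup C
      loose′ : #comp (∁ᶠ (δᶠ A)) + cnt A + 1 ≤ cnt (δᶠ A) + 1 + 0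
      loose′ = subst (λ c → #comp (∁ᶠ (δᶠ A)) + cnt A + 1 ≤ cnt (δᶠ A) + c + 0) (#comp-E v₀) loose
      bond≡ : bondRank G (δ G C) ≡ cnt (δᶠ A) + (n G ∸ #comp (∁ᶠ (δᶠ A))) ∸ (n G ∸ 1)
      bond≡ = trans (cong (∣ δ G C ∣ + graphicRank G (∁ (δ G C)) ∸_) (graphicRank-⊤ v₀))
                (cong₂ (λ d c → d + (n G ∸ c) ∸ (n G ∸ 1))
                  (trans (size-cnt (δ G C)) (cnt-cong (lookup∘tabulate (δᶠ A))))
                  (trans (components≡#comp (∁ (δ G C)))
                         (#comp-cong (λ e → trans (lookup-map e not (δ G C)) (cong not (lookup∘tabulate (δᶠ A) e))))))

tight⇒dependent : ∀ G A → Nonempty A → Tight G A → ¬ Independent G A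
tight⇒dependent G A = go ∣ A ∣ A ≤-refl
  where
  go : ∀ k A → ∣ A ∣ ≤ k → Nonempty A → Tight G A → ¬ Independent G A
  go k A bound nonempty tight independent = independent A (λ x∈A → x∈A) (nonempty , tight , minimal k bound)
    where
    minimal : ∀ k → ∣ A ∣ ≤ k → ∀ B → Nonempty B → B ⊂ A → ¬ Tight G B
    minimal zero    bound B _ B⊂A _ = ≤⇒≯ bound (≤-<-trans z≤n (p⊂q⇒∣p∣<∣q∣ B⊂A))
    minimal (suc k) bound B nonempty-B B⊂A tight-B =
      go k B (≤-pred (≤-trans (p⊂q⇒∣p∣<∣q∣ B⊂A) bound)) nonempty-B tight-B
         (λ C C⊆B → independent C (proj₁ B⊂A ∘ C⊆B))

genus∸1 : ∀ G → genus G ∸ 1 ≡ m G ∸ n G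
genus∸1 G = trans (∸-+-assoc (m G + 1) (n G) 1) (cong₂ _∸_ (+-comm (m G) 1) (+-comm (n G) 1))

module _ (G : Graph) (trivalent : Trivalent G) (two-edge-connected : TwoEdgeConnected G) (v₀ : Vertex G) where
  open Construction G trivalent two-edge-connected

  independent-≤ : ∀ I → Independent G I → ∣ I ∣ ≤ genus G ∸ 1
  independent-≤ I independent with ∣ I ∣ ≤? genus G ∸ 1
  ... | yes small = small
  ... | no large  = ⊥-elim (tight⇒dependent G I nonempty tight independent)
    where
    genus≤∣I∣ : genus G ≤ ∣ I ∣
    genus≤∣I∣ = ≤-trans (n≤1+[n∸1] (genus G)) (≰⇒> large)
      where
      n≤1+[n∸1] : ∀ k → k ≤ suc (k ∸ 1)
      n≤1+[n∸1] zero    = z≤n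
      n≤1+[n∸1] (suc k) = ≤-refl
    tight : Tight G I
    tight = ≤-trans (bondRank≤genus v₀ (δ G I)) genus≤∣I∣
    nonempty : Nonempty I
    nonempty = let (v , Iv) = cnt-pos⇒∃ (lookup I) (subst (1 ≤_) (size-cnt I) (≤-trans (s≤s z≤n) (≰⇒> large)))
               in v , lookup⇒[]= v I Iv

  independent-of-size : ∃ λ I → Independent G I × ∣ I ∣ ≡ genus G ∸ 1
  independent-of-size = tabulate I , independent , size
    where
    I : VertexSet G
    I = proj₁ (independent-set v₀)
    loose : ∀ A → A ⊑ I → (∃ λ v → A v ≡ true) → Loose G (λ _ → true) A 0
    loose = proj₂ (proj₂ (independent-set v₀))
    size : ∣ tabulate I ∣ ≡ genus G ∸ 1
    size = begin
      ∣ tabulate I ∣          ≡⟨ trans (size-cnt (tabulate I)) (cnt-cong (lookup∘tabulate I)) ⟩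
      cnt I                   ≡⟨ sym (m+n∸n≡m (cnt I) (n G)) ⟩
      cnt I + n G ∸ n G       ≡⟨ cong (_∸ n G) (proj₁ (proj₂ (independent-set v₀))) ⟩
      m G ∸ n G               ≡⟨ sym (genus∸1 G) ⟩
      genus G ∸ 1             ∎
      where open ≡-Reasoning
    independent : Independent G (tabulate I)
    independent C C⊆I ((v , v∈C) , tight , _) =
      loose⇒¬tight v₀ C (loose (lookup C) C⊑I (v , []=⇒lookup v∈C)) tight
      where
      C⊑I : lookup C ⊑ I
      C⊑I u p = trans (sym (lookup∘tabulate I u)) ([]=⇒lookup (C⊆I (lookup⇒[]= u C p)))

vertex-or-empty : ∀ G → Vertex G ⊎ n G ≡ 0
vertex-or-empty G with n G
... | zero  = inj₂ refl
... | suc _ = inj₁ fz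

no-vertices⇒no-edges : ∀ G → n G ≡ 0 → m G ≡ 0
no-vertices⇒no-edges G n≡0 with m G | ends G
... | zero  | _    = refl
... | suc _ | ends = ⊥-elim (¬Fin0 (subst Fin n≡0 (proj₁ (ends fz))))

rank-without-vertices : ∀ G → n G ≡ 0 → MatroidRank G (genus G ∸ 1)
rank-without-vertices G n≡0 =
  (⊤ , (λ C _ ((v , _) , _) → ¬Fin0 (subst Fin n≡0 v)) , trans (n≤0⇒n≡0 (size-bound ⊤)) (sym genus≡0)) ,
  (λ I _ → ≤-trans (size-bound I) z≤n)
  where
  size-bound : ∀ I → ∣ I ∣ ≤ 0
  size-bound I = ≤-trans (∣p∣≤n I) (≤-reflexive n≡0)
  genus≡0 : genus G ∸ 1 ≡ 0
  genus≡0 = trans (genus∸1 G) (cong₂ _∸_ (no-vertices⇒no-edges G n≡0) n≡0)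

proposition4p3 : (G : Graph) → Trivalent G → TwoEdgeConnected G → MatroidRank G (genus G ∸ 1)
proposition4p3 G trivalent two-edge-connected with vertex-or-empty G
... | inj₂ n≡0 = rank-without-vertices G n≡0
... | inj₁ v₀  = independent-of-size G trivalent two-edge-connected v₀ ,
                 independent-≤ G trivalent two-edge-connected v₀
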